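{- Let $d\in\mathbb N$. For every sentence $\phi$ of $\mathrm{FO}+\mathrm{MOD}$ there exist $k\in\mathbb N$ and an $\mathrm{FO}+\mathrm{MOD}$ sentence $\psi$ with $\phi\equiv_d\psi$, where $\psi$ is a disjunction of conjunctions of atoms, each atom being of one of the forms (i) $\exists^{\ge k}x(r,\tau)$ for some $r\in\mathbb N$, $\tau\in T_{\mathrm{ball}}(r,d)$; (ii) $\exists^{=m}x(r,\tau)$ for some $m\in\mathbb N$ with $m<k$, $r\in\mathbb N$, $\tau\in T_{\mathrm{ball}}(r,d)$; (iii) $\exists^{j(\mathrm{mod}\ \ell)}x(r,\tau)$ for some $j,\ell\in\mathbb N$ with $j<\ell$, $r\in\mathbb N$, $\tau\in T_{\mathrm{ball}}(r,d)$. Moreover, if $\phi$ is in Hanf normal form, $\psi$ can be chosen such that every radius and type occurring in these atoms is the radius and type of some Hanf sentence occurring in $\phi$.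
   Context: Graphs are finite, simple, undirected. $\mathrm{FO}+\mathrm{MOD}$ is first-order logic over the edge relation extended by modular counting quantifiers. For a graph $G$, vertex $v$, $r\in\mathbb N$, $B_G(v,r)$ is the subgraph induced by the vertices at distance $\le r$ from $v$, rooted at $v$. $T_{\mathrm{ball}}(r,d)$ is the finite set of root-preserving isomorphism types of rooted graphs of maximum degree $\le d$ with all vertices within distance $r$ of the root. $\exists^{\ge m}x(r,\tau)$ states that at least $m$ distinct vertices $x$ have $B_G(x,r)$ of type $\tau$; $\exists^{=m}x(r,\tau)$ states exactly $m$ such vertices exist; $\exists^{j(\mathrm{mod}\ \ell)}x(r,\tau)$ states that the number of such vertices is $\equiv j \bmod \ell$. Hanf sentences are those of the forms $\exists^{\ge m}x(r,\tau)$ and $\exists^{j(\mathrm{mod}\ \ell)}x(r,\tau)$ (radius $r$, type $\tau$); a sentence is in Hanf normal form if it is a Boolean combination of Hanf sentences. $\phi\equiv_d\psi$ means every graph of maximum degree at most $d$ satisfies $\phi$ iff it satisfies $\psi$. -}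

module Defs where

open import Data.Nat using (ℕ; zero; suc; _+_; _≤_; _<_; _%_; _≡ᵇ_)
open import Data.Bool using (Bool; true; false; _∧_; _∨_; not; if_then_else_)
open import Data.Fin using (Fin; zero; suc; _≟_)
open import Data.Product using (Σ; _×_; _,_; ∃)
open import Data.Sum using (_⊎_)
open import Relation.Nullary using (¬_)
open import Data.List using (List)
open import Data.List.Relation.Unary.Any using (Any)
open import Data.List.Relation.Unary.All using (All)
open import Relation.Binary.PropositionalEquality using (_≡_)
open import Relation.Nullary.Decidable using (⌊_⌋)
open import Function.Definitions using (Injective)

countFin : (n : ℕ) → (Fin n → Bool) → ℕ
countFin zero    p = 0
countFin (suc n) p = (if p zero then 1 else 0) + countFin n (λ i → p (suc i))

anyFin : (n : ℕ) → (Fin n → Bool) → Bool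
anyFin zero    p = false
anyFin (suc n) p = p zero ∨ anyFin n (λ i → p (suc i))

-- congruence modulo ℓ (for ℓ = 0 it is plain equality; only ℓ ≥ 1 is used)
CongMod : ℕ → ℕ → ℕ → Set
CongMod a b zero    = a ≡ b
CongMod a b (suc l) = a % suc l ≡ b % suc l

congModᵇ : ℕ → ℕ → ℕ → Bool
congModᵇ a b zero    = a ≡ᵇ b
congModᵇ a b (suc l) = (a % suc l) ≡ᵇ (b % suc l)

record Graph : Set where
  field
    size   : ℕ
    adj    : Fin size → Fin size → Bool
    sym    : ∀ u v → adj u v ≡ adj v u
    irrefl : ∀ v → adj v v ≡ false
open Graph public

Vertex : Graph → Set
Vertex G = Fin (size G)

degree : (G : Graph) → Vertex G → ℕ
degree G v = countFin (size G) (adj G v)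

MaxDeg≤ : Graph → ℕ → Set
MaxDeg≤ G d = ∀ v → degree G v ≤ d

-- reach G v r u = true  iff  dist_G(v,u) ≤ r
reach : (G : Graph) → Vertex G → ℕ → Vertex G → Bool
reach G v zero    u = ⌊ v ≟ u ⌋
reach G v (suc r) u = reach G v r u ∨ anyFin (size G) (λ w → reach G v r w ∧ adj G w u)

record RootedGraph : Set where
  constructor rooted
  field
    graph : Graph
    root  : Vertex graph
open RootedGraph public

-- τ ∈ T_ball(r,d) (τ a representative of the isomorphism type):
-- maximum degree ≤ d and every vertex within distance r of the root
InTball : ℕ → ℕ → RootedGraph → Set
InTball r d τ = MaxDeg≤ (graph τ) d × (∀ u → reach (graph τ) (root τ) r u ≡ true)

RootedIso : RootedGraph → RootedGraph → Set
RootedIso σ τ =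
  Σ (Vertex (graph σ) → Vertex (graph τ)) λ f →
  Σ (Vertex (graph τ) → Vertex (graph σ)) λ g →
    (∀ x → g (f x) ≡ x) × (∀ y → f (g y) ≡ y) ×
    (f (root σ) ≡ root τ) ×
    (∀ x y → adj (graph τ) (f x) (f y) ≡ adj (graph σ) x y)

-- B_G(v,r) has type τ: a root-preserving isomorphism between τ and the
-- subgraph of G induced by the vertices at distance ≤ r from v, rooted at v.
-- (given as an injective map from τ onto the ball, sending root to v and
-- preserving and reflecting adjacency)
HasBallType : (G : Graph) → Vertex G → ℕ → RootedGraph → Set
HasBallType G v r τ =
  Σ (Vertex (graph τ) → Vertex G) λ f →
    Injective _≡_ _≡_ f ×
    (f (root τ) ≡ v) ×
    (∀ w → reach G v r (f w) ≡ true) ×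
    (∀ u → reach G v r u ≡ true → ∃ λ w → f w ≡ u) ×
    (∀ w w' → adj G (f w) (f w') ≡ adj (graph τ) w w')

AtLeast : (G : Graph) → ℕ → ℕ → RootedGraph → Set
AtLeast G m r τ =
  Σ (Fin m → Vertex G) λ g → Injective _≡_ _≡_ g × (∀ i → HasBallType G (g i) r τ)

Exactly : (G : Graph) → ℕ → ℕ → RootedGraph → Set
Exactly G m r τ =
  Σ (Fin m → Vertex G) λ g → Injective _≡_ _≡_ g × (∀ i → HasBallType G (g i) r τ) ×
    (∀ x → HasBallType G x r τ → ∃ λ i → g i ≡ x)

CountMod : (G : Graph) → ℕ → ℕ → ℕ → RootedGraph → Set
CountMod G j ℓ r τ = Σ ℕ λ m → Exactly G m r τ × CongMod m j ℓ

-- FO+MOD over the edge relation (de Bruijn variables; Formula n has n free vars)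

data Formula : ℕ → Set where
  edge   : ∀ {n} → Fin n → Fin n → Formula n
  equal  : ∀ {n} → Fin n → Fin n → Formula n
  neg    : ∀ {n} → Formula n → Formula n
  conj   : ∀ {n} → Formula n → Formula n → Formula n
  disj   : ∀ {n} → Formula n → Formula n → Formula n
  ex     : ∀ {n} → Formula (suc n) → Formula n
  all    : ∀ {n} → Formula (suc n) → Formula n
  exMod  : ∀ {n} → (j ℓ : ℕ) → 1 ≤ ℓ → Formula (suc n) → Formula n

Sentence : Set
Sentence = Formula 0

extend : ∀ {A : Set} {n} → (Fin n → A) → A → Fin (suc n) → A
extend a v zero    = v
extend a v (suc i) = a i

sat : (G : Graph) → ∀ {n} → Formula n → (Fin n → Vertex G) → Bool
sat G (edge i j)       a = adj G (a i) (a j)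
sat G (equal i j)      a = ⌊ a i ≟ a j ⌋
sat G (neg φ)          a = not (sat G φ a)
sat G (conj φ ψ)       a = sat G φ a ∧ sat G ψ a
sat G (disj φ ψ)       a = sat G φ a ∨ sat G ψ a
sat G (ex φ)           a = anyFin (size G) (λ v → sat G φ (extend a v))
sat G (all φ)          a = not (anyFin (size G) (λ v → not (sat G φ (extend a v))))
sat G (exMod j ℓ _ φ)  a = congModᵇ (countFin (size G) (λ v → sat G φ (extend a v))) j ℓ

_⊨_ : Graph → Sentence → Set
G ⊨ φ = sat G φ (λ ()) ≡ true

data HanfSentence (d : ℕ) : Set where
  hAtLeast : (m r : ℕ) (τ : RootedGraph) → InTball r d τ → HanfSentence d
  hMod     : (j ℓ : ℕ) → 1 ≤ ℓ → (r : ℕ) (τ : RootedGraph) → InTball r d τ → HanfSentence d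

⟦_⟧ʰ : ∀ {d} → HanfSentence d → Graph → Set
⟦ hAtLeast m r τ _ ⟧ʰ  G = AtLeast G m r τ
⟦ hMod j ℓ _ r τ _ ⟧ʰ  G = CountMod G j ℓ r τ

data HNF (d : ℕ) : Set where
  hanf  : HanfSentence d → HNF d
  hneg  : HNF d → HNF d
  hconj : HNF d → HNF d → HNF d
  hdisj : HNF d → HNF d → HNF d

⟦_⟧ᴴ : ∀ {d} → HNF d → Graph → Set
⟦ hanf h ⟧ᴴ      G = ⟦ h ⟧ʰ G
⟦ hneg φ ⟧ᴴ      G = ¬ ⟦ φ ⟧ᴴ G
⟦ hconj φ ψ ⟧ᴴ   G = ⟦ φ ⟧ᴴ G × ⟦ ψ ⟧ᴴ G
⟦ hdisj φ ψ ⟧ᴴ   G = ⟦ φ ⟧ᴴ G ⊎ ⟦ ψ ⟧ᴴ G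

OccursHʳ : ∀ {d} → ℕ → RootedGraph → HanfSentence d → Set
OccursHʳ r τ (hAtLeast _ r' τ' _)  = (r ≡ r') × RootedIso τ τ'
OccursHʳ r τ (hMod _ _ _ r' τ' _)  = (r ≡ r') × RootedIso τ τ'

OccursIn : ∀ {d} → ℕ → RootedGraph → HNF d → Set
OccursIn r τ (hanf h)    = OccursHʳ r τ h
OccursIn r τ (hneg φ)    = OccursIn r τ φ
OccursIn r τ (hconj φ ψ) = OccursIn r τ φ ⊎ OccursIn r τ ψ
OccursIn r τ (hdisj φ ψ) = OccursIn r τ φ ⊎ OccursIn r τ ψ

data Atom (d k : ℕ) : Set where
  atLeastK : (r : ℕ) (τ : RootedGraph) → InTball r d τ → Atom d k
  exactlyM : (m : ℕ) → m < k → (r : ℕ) (τ : RootedGraph) → InTball r d τ → Atom d k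
  modJ     : (j ℓ : ℕ) → j < ℓ → (r : ℕ) (τ : RootedGraph) → InTball r d τ → Atom d k

⟦_⟧ᵃ : ∀ {d k} → Atom d k → Graph → Set
⟦_⟧ᵃ {k = k} (atLeastK r τ _) G = AtLeast G k r τ
⟦ exactlyM m _ r τ _ ⟧ᵃ  G = Exactly G m r τ
⟦ modJ j ℓ _ r τ _ ⟧ᵃ    G = CountMod G j ℓ r τ

atomRadius : ∀ {d k} → Atom d k → ℕ
atomRadius (atLeastK r _ _)     = r
atomRadius (exactlyM _ _ r _ _) = r
atomRadius (modJ _ _ _ r _ _)   = r

atomType : ∀ {d k} → Atom d k → RootedGraph
atomType (atLeastK _ τ _)     = τ
atomType (exactlyM _ _ _ τ _) = τ
atomType (modJ _ _ _ _ τ _)   = τ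

DNF : ℕ → ℕ → Set
DNF d k = List (List (Atom d k))

⟦_⟧ᴰ : ∀ {d k} → DNF d k → Graph → Set
⟦ ψ ⟧ᴰ G = Any (All (λ a → ⟦ a ⟧ᵃ G)) ψ

_≡[_]_ : (Graph → Set) → ℕ → (Graph → Set) → Set
P ≡[ d ] Q = ∀ G → MaxDeg≤ G d → (P G → Q G) × (Q G → P G)

-- A formula with free variables is represented by a local form: finitely many Hanf
-- sentences and, for each choice of their truth values, a query that depends only on
-- the isomorphism type of the r-neighbourhood of the free variables. A quantifier ∃y
-- is eliminated by splitting the witnesses y into those near the free variables, which
-- are counted locally, and the far ones: a far y whose r-ball has type τ may be
-- replaced by the root of a fresh copy of τ placed beside the graph, so the far
-- witnesses of type τ number the τ-balls minus the near ones. Since degrees are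
-- bounded there are finitely many types and boundedly many near vertices, so these
-- numbers are read off from Hanf sentences ∃^{≥c} and ∃^{c (mod ℓ)}; the modular
-- quantifier is handled in the same way. A sentence has no free variables, so its
-- query is constant and Shannon expansion over its Hanf sentences gives a Hanf normal
-- form. Pushing negations down to the Hanf sentences then gives the disjunctive
-- form: for k above all thresholds, ∃^{≥m} is ∃^{≥k} or some ∃^{=i} with m ≤ i < k,
-- its negation is some ∃^{=i} with i < m, and a failed congruence is a congruence to
-- one of the other residues.

module Submission where

open import Defs
open import Data.Bool using (Bool; true; false; _∧_; _∨_; not; if_then_else_)
open import Data.Bool.Properties using (∨-zeroʳ; ∨-identityʳ; ∧-zeroʳ; ∧-identityʳ; not-involutive; T-≡)
import Data.Bool.Properties as Bool
open import Data.Empty using (⊥; ⊥-elim)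
open import Data.Fin using (Fin; zero; suc; toℕ; fromℕ<; inject≤; _↑ˡ_; _↑ʳ_; splitAt; _≟_)
open import Data.Fin.Properties
  using ( any?; all?; injective⇒≤; inject≤-injective; suc-injective; toℕ-fromℕ<; toℕ<n; toℕ-injective
        ; ↑ˡ-injective; ↑ʳ-injective; splitAt-↑ˡ; splitAt-↑ʳ; splitAt⁻¹-↑ˡ; splitAt⁻¹-↑ʳ)
import Data.Vec.Functional as Vector
open import Data.List
  using (List; []; _∷_; [_]; _++_; map; filter; concatMap; cartesianProductWith; allFin; upTo; length; lookup; deduplicate)
open import Data.List.Membership.Propositional using (find; lose)
open import Data.List.Membership.Propositional.Properties using (∈-allFin; ∈-applyUpTo⁺; ∈-filter⁺; ∈-filter⁻)
open import Data.List.Relation.Unary.All using (All; []; _∷_)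
import Data.List.Relation.Unary.All as All
import Data.List.Relation.Unary.All.Properties as Allₚ
open import Data.List.Relation.Unary.AllPairs using (AllPairs; []; _∷_)
import Data.List.Relation.Unary.AllPairs as AllPairs
import Data.List.Relation.Unary.AllPairs.Properties as AllPairsₚ
open import Data.List.Relation.Unary.Any using (Any; here; there)
import Data.List.Relation.Unary.Any as Any
import Data.List.Relation.Unary.Any.Properties as Anyₚ
open import Data.Nat
  using (ℕ; zero; suc; _+_; _*_; _^_; _≤_; _<_; _≤′_; ≤′-refl; ≤′-step; _≤?_; _<?_; _≤ᵇ_; _≡ᵇ_; _%_; _⊔_; z≤n; s≤s)
import Data.Nat.Properties as ℕ
open import Data.Nat.Properties
  using ( ≤-refl; ≤-trans; ≤-antisym; ≤-reflexive; <-≤-trans; <⇒≱; ≰⇒>; ≤⇒≤′; n≤1+n; m≤m+n; m≤n+m; m≤m⊔n; m≤n⊔m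
        ; m⊔n≤o⇒m≤o; m⊔n≤o⇒n≤o; +-mono-≤; +-monoʳ-≤; *-monoˡ-≤; *-monoʳ-≤; +-assoc; +-comm; +-suc; +-identityʳ
        ; *-comm; *-suc; *-identityʳ; *-distribˡ-+; ≤ᵇ⇒≤; ≤⇒≤ᵇ; ≡ᵇ⇒≡; ≡⇒≡ᵇ)
open import Algebra.Properties.CommutativeMonoid.Sum ℕ.+-0-commutativeMonoid
  using (sum-syntax; sum-cong-≗; ∑-distrib-+; ∑-comm)
open import Algebra.Properties.Semiring.Sum ℕ.+-*-semiring using (*-distribˡ-sum; *-distribʳ-sum)
open import Data.Nat.DivMod using (%-distribˡ-+; m%n%n≡m%n; [m+kn]%n≡m%n; m<n⇒m%n≡m; m%n<n)
open import Data.Product using (Σ; ∃; _×_; _,_; proj₁; proj₂; map₂)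
import Data.Product as Product
open import Data.Product.Function.NonDependent.Propositional using (_×-⇔_)
open import Data.Sum using (_⊎_; inj₁; inj₂; [_,_]′)
open import Data.Sum.Function.Propositional using (_⊎-⇔_)
open import Data.Unit using (⊤; tt)
open import Function using (_∘_; id; case_of_; _⇔_; mk⇔; Equivalence)
open import Function.Construct.Composition using (_⇔-∘_)
open import Function.Definitions using (Injective)
open import Relation.Binary.PropositionalEquality using (_≡_; _≢_; refl; cong; cong₂; subst; _≗_; module ≡-Reasoning)
import Relation.Binary.PropositionalEquality as ≡
open import Relation.Nullary using (Dec; yes; no; ¬_; ¬?)
open import Relation.Nullary.Decidable using (⌊_⌋; map′; _×-dec_; _→-dec_)
open import Relation.Unary using (Decidable)

true⇔⇒≡ : ∀ {a b} → (a ≡ true → b ≡ true) → (b ≡ true → a ≡ true) → a ≡ b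
true⇔⇒≡ {false} {false} _ _ = refl
true⇔⇒≡ {false} {true}  _ g = g refl
true⇔⇒≡ {true}  {false} f _ = ≡.sym (f refl)
true⇔⇒≡ {true}  {true}  _ _ = refl

∧-true⁻ : ∀ {a b} → a ∧ b ≡ true → a ≡ true × b ≡ true
∧-true⁻ {true} {true} _ = refl , refl

∧-true⁺ : ∀ {a b} → a ≡ true → b ≡ true → a ∧ b ≡ true
∧-true⁺ refl refl = refl

∨-true⁻ : ∀ {a b} → a ∨ b ≡ true → a ≡ true ⊎ b ≡ true
∨-true⁻ {true}  _ = inj₁ refl
∨-true⁻ {false} e = inj₂ e

∨-true⁺ˡ : ∀ {a} b → a ≡ true → a ∨ b ≡ true
∨-true⁺ˡ b refl = refl

∨-true⁺ʳ : ∀ a {b} → b ≡ true → a ∨ b ≡ true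
∨-true⁺ʳ a refl = ∨-zeroʳ a

¬⇔≡false : ∀ {A : Set} {x} → A ⇔ (x ≡ true) → (¬ A) ⇔ (x ≡ false)
¬⇔≡false {x = false} A⇔x = mk⇔ (λ _ → refl) (λ _ a → case Equivalence.to A⇔x a of λ ())
¬⇔≡false {x = true}  A⇔x = mk⇔ (λ ¬a → ⊥-elim (¬a (Equivalence.from A⇔x refl))) (λ ())

not≡⇔ : ∀ x b → (x ≡ not b) ⇔ (not x ≡ b)
not≡⇔ x b = mk⇔ (λ e → ≡.trans (cong not e) (not-involutive b)) (λ e → ≡.trans (≡.sym (not-involutive x)) (cong not e))

∧≡true⇔ : ∀ x y → (x ≡ true × y ≡ true) ⇔ (x ∧ y ≡ true)
∧≡true⇔ x y = mk⇔ (λ (p , q) → ∧-true⁺ p q) ∧-true⁻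

∨≡true⇔ : ∀ x y → (x ≡ true ⊎ y ≡ true) ⇔ (x ∨ y ≡ true)
∨≡true⇔ x y = mk⇔ [ ∨-true⁺ˡ y , ∨-true⁺ʳ x ]′ ∨-true⁻

∧≡false⇔ : ∀ x y → (x ≡ false ⊎ y ≡ false) ⇔ (x ∧ y ≡ false)
∧≡false⇔ false y = mk⇔ (λ _ → refl) (λ _ → inj₁ refl)
∧≡false⇔ true  y = mk⇔ [ (λ ()) , id ]′ inj₂

∨≡false⇔ : ∀ x y → (x ≡ false × y ≡ false) ⇔ (x ∨ y ≡ false)
∨≡false⇔ false y = mk⇔ proj₂ (refl ,_)
∨≡false⇔ true  y = mk⇔ (λ { (() , _) }) (λ ())

indicator : Bool → ℕ
indicator b = if b then 1 else 0

indicator-∧ : ∀ a b → indicator (a ∧ b) ≡ indicator a * indicator b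
indicator-∧ false b = refl
indicator-∧ true  b = ≡.sym (+-identityʳ (indicator b))

indicator-∧-not : ∀ a b → indicator a ≡ indicator (a ∧ b) + indicator (a ∧ not b)
indicator-∧-not false b     = refl
indicator-∧-not true  false = refl
indicator-∧-not true  true  = refl

anyFin⁺ : ∀ n (p : Fin n → Bool) i → p i ≡ true → anyFin n p ≡ true
anyFin⁺ (suc n) p zero    pi = ∨-true⁺ˡ _ pi
anyFin⁺ (suc n) p (suc i) pi = ∨-true⁺ʳ (p zero) (anyFin⁺ n (p ∘ suc) i pi)

anyFin⁻ : ∀ n (p : Fin n → Bool) → anyFin n p ≡ true → ∃ λ i → p i ≡ true
anyFin⁻ (suc n) p e with ∨-true⁻ {p zero} e
... | inj₁ p0 = zero , p0
... | inj₂ ps = let i , pi = anyFin⁻ n (p ∘ suc) ps in suc i , pi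

anyFin-cong : ∀ n {p q : Fin n → Bool} → p ≗ q → anyFin n p ≡ anyFin n q
anyFin-cong zero    p≗q = refl
anyFin-cong (suc n) p≗q = cong₂ _∨_ (p≗q zero) (anyFin-cong n (p≗q ∘ suc))

countFin-cong : ∀ n {p q : Fin n → Bool} → p ≗ q → countFin n p ≡ countFin n q
countFin-cong zero    p≗q = refl
countFin-cong (suc n) p≗q = cong₂ (λ b c → indicator b + c) (p≗q zero) (countFin-cong n (p≗q ∘ suc))

countFin-false : ∀ n → countFin n (λ _ → false) ≡ 0
countFin-false zero    = refl
countFin-false (suc n) = countFin-false n

countFin≡∑ : ∀ n (p : Fin n → Bool) → countFin n p ≡ ∑[ i < n ] indicator (p i)
countFin≡∑ zero    p = refl
countFin≡∑ (suc n) p = cong (indicator (p zero) +_) (countFin≡∑ n (p ∘ suc))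

anyFin≡1≤ᵇcountFin : ∀ n (p : Fin n → Bool) → anyFin n p ≡ (1 ≤ᵇ countFin n p)
anyFin≡1≤ᵇcountFin zero    p = refl
anyFin≡1≤ᵇcountFin (suc n) p with p zero
... | true  = refl
... | false = anyFin≡1≤ᵇcountFin n (p ∘ suc)

Enumeration : ∀ n → (Fin n → Bool) → ℕ → Set
Enumeration n p m =
  Σ (Fin m → Fin n) λ g →
    Injective _≡_ _≡_ g × (∀ i → p (g i) ≡ true) × (∀ x → p x ≡ true → ∃ λ i → g i ≡ x)

enumerate : ∀ n (p : Fin n → Bool) → Enumeration n p (countFin n p)
enumerate zero    p = (λ ()) , (λ { {()} }) , (λ ()) , (λ ())
enumerate (suc n) p with p zero in p0 | enumerate n (p ∘ suc)
... | false | g , g-inj , g-sound , g-onto = suc ∘ g , g-inj ∘ suc-injective , g-sound , onto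
  where
  onto : ∀ x → p x ≡ true → ∃ λ i → suc (g i) ≡ x
  onto zero    px with () ← ≡.trans (≡.sym px) p0
  onto (suc x) px = let i , gi = g-onto x px in i , cong suc gi
... | true  | g , g-inj , g-sound , g-onto = h , h-inj , h-sound , h-onto
  where
  h : Fin (suc (countFin n (p ∘ suc))) → Fin (suc n)
  h zero    = zero
  h (suc i) = suc (g i)
  h-inj : Injective _≡_ _≡_ h
  h-inj {zero}  {zero}  _ = refl
  h-inj {suc i} {suc j} e = cong suc (g-inj (suc-injective e))
  h-sound : ∀ i → p (h i) ≡ true
  h-sound zero    = p0
  h-sound (suc i) = g-sound i
  h-onto : ∀ x → p x ≡ true → ∃ λ i → h i ≡ x
  h-onto zero    _  = zero , refl
  h-onto (suc x) px = let i , gi = g-onto x px in suc i , cong suc gi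

Injection : ∀ n → (Fin n → Bool) → ℕ → Set
Injection n p m = Σ (Fin m → Fin n) λ g → Injective _≡_ _≡_ g × (∀ i → p (g i) ≡ true)

injection⇒≤countFin : ∀ n (p : Fin n → Bool) {m} → Injection n p m → m ≤ countFin n p
injection⇒≤countFin n p {m} (g , g-inj , g-sound) with enumerate n p
... | e , _ , _ , e-onto = injective⇒≤ {f = index} index-inj
  where
  index : Fin m → Fin (countFin n p)
  index j = proj₁ (e-onto (g j) (g-sound j))
  e∘index : ∀ j → e (index j) ≡ g j
  e∘index j = proj₂ (e-onto (g j) (g-sound j))
  index-inj : Injective _≡_ _≡_ index
  index-inj {i} {j} eq = g-inj (≡.trans (≡.sym (e∘index i)) (≡.trans (cong e eq) (e∘index j)))

countFin-≤-via : ∀ {n m} (p : Fin n → Bool) (q : Fin m → Bool) (R : Fin n → Fin m → Set) →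
  (∀ x → p x ≡ true → ∃ λ y → R x y × q y ≡ true) →
  (∀ {x x′ y} → R x y → R x′ y → x ≡ x′) →
  countFin n p ≤ countFin m q
countFin-≤-via {n} {m} p q R total injective with enumerate n p
... | e , e-inj , e-sound , _ = injection⇒≤countFin m q (image , image-inj , λ j → proj₂ (proj₂ (related j)))
  where
  related : ∀ j → ∃ λ y → R (e j) y × q y ≡ true
  related j = total (e j) (e-sound j)
  image = λ j → proj₁ (related j)
  image-inj : Injective _≡_ _≡_ image
  image-inj {i} {j} eq =
    e-inj (injective (proj₁ (proj₂ (related i))) (subst (R (e j)) (≡.sym eq) (proj₁ (proj₂ (related j)))))

countFin-true : ∀ n → countFin n (λ _ → true) ≡ n
countFin-true zero    = refl
countFin-true (suc n) = cong suc (countFin-true n)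

enumeration⇒countFin≡ : ∀ n (p : Fin n → Bool) {m} → Enumeration n p m → countFin n p ≡ m
enumeration⇒countFin≡ n p {m} (g , g-inj , g-sound , g-onto) = ≤-antisym
  (≤-trans (countFin-≤-via p (λ _ → true) (λ x i → g i ≡ x)
              (λ x px → let i , gi = g-onto x px in i , gi , refl)
              (λ gi≡x gi≡x′ → ≡.trans (≡.sym gi≡x) gi≡x′))
           (≤-reflexive (countFin-true m)))
  (injection⇒≤countFin n p (g , g-inj , g-sound))

≤countFin⇒injection : ∀ n (p : Fin n → Bool) {m} → m ≤ countFin n p → Injection n p m
≤countFin⇒injection n p m≤c with enumerate n p
... | e , e-inj , e-sound , _ =
  (λ i → e (inject≤ i m≤c)) , (λ eq → inject≤-injective m≤c m≤c _ _ (e-inj eq)) , (λ i → e-sound (inject≤ i m≤c))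

countFin-mono : ∀ n {p q : Fin n → Bool} → (∀ i → p i ≡ true → q i ≡ true) → countFin n p ≤ countFin n q
countFin-mono n {p} {q} p⇒q = countFin-≤-via p q _≡_ (λ x px → x , refl , p⇒q x px) (λ x≡y x′≡y → ≡.trans x≡y (≡.sym x′≡y))

countFin-≡-via : ∀ {n m} (p : Fin n → Bool) (q : Fin m → Bool) (R : Fin n → Fin m → Set) →
  (∀ x → p x ≡ true → ∃ λ y → R x y × q y ≡ true) →
  (∀ y → q y ≡ true → ∃ λ x → R x y × p x ≡ true) →
  (∀ {x y y′} → R x y → R x y′ → y ≡ y′) →
  (∀ {x x′ y} → R x y → R x′ y → x ≡ x′) →
  countFin n p ≡ countFin m q
countFin-≡-via p q R total onto functional injective = ≤-antisym
  (countFin-≤-via p q R total injective)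
  (countFin-≤-via q p (λ y x → R x y) onto functional)

∑-mono-≤ : ∀ n {f g : Fin n → ℕ} → (∀ i → f i ≤ g i) → ∑[ i < n ] f i ≤ ∑[ i < n ] g i
∑-mono-≤ zero    f≤g = z≤n
∑-mono-≤ (suc n) f≤g = +-mono-≤ (f≤g zero) (∑-mono-≤ n (f≤g ∘ suc))

countFin-split : ∀ n (p q : Fin n → Bool) →
  countFin n p ≡ countFin n (λ i → p i ∧ q i) + countFin n (λ i → p i ∧ not (q i))
countFin-split n p q = begin
  countFin n p
    ≡⟨ countFin≡∑ n p ⟩
  ∑[ i < n ] indicator (p i)
    ≡⟨ sum-cong-≗ {n} (λ i → indicator-∧-not (p i) (q i)) ⟩
  ∑[ i < n ] (indicator (p i ∧ q i) + indicator (p i ∧ not (q i)))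
    ≡⟨ ∑-distrib-+ {n} _ _ ⟩
  ∑[ i < n ] indicator (p i ∧ q i) + ∑[ i < n ] indicator (p i ∧ not (q i))
    ≡⟨ cong₂ _+_ (≡.sym (countFin≡∑ n _)) (≡.sym (countFin≡∑ n _)) ⟩
  countFin n (λ i → p i ∧ q i) + countFin n (λ i → p i ∧ not (q i))
    ∎
  where open ≡-Reasoning

countFin-partition : ∀ n T (p : Fin n → Bool) (q : Fin T → Fin n → Bool) →
  (∀ y → ∑[ t < T ] indicator (q t y) ≡ 1) →
  countFin n p ≡ ∑[ t < T ] countFin n (λ y → p y ∧ q t y)
countFin-partition n T p q one-class = ≡.sym (begin
  ∑[ t < T ] countFin n (λ y → p y ∧ q t y)
    ≡⟨ sum-cong-≗ {T} (λ t → countFin≡∑ n _) ⟩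
  ∑[ t < T ] ∑[ y < n ] indicator (p y ∧ q t y)
    ≡⟨ ∑-comm {T} {n} _ ⟩
  ∑[ y < n ] ∑[ t < T ] indicator (p y ∧ q t y)
    ≡⟨ sum-cong-≗ {n} (λ y → sum-cong-≗ {T} (λ t → indicator-∧ (p y) (q t y))) ⟩
  ∑[ y < n ] ∑[ t < T ] (indicator (p y) * indicator (q t y))
    ≡⟨ sum-cong-≗ {n} (λ y → *-distribˡ-sum {T} (indicator (p y)) (λ t → indicator (q t y))) ⟨
  ∑[ y < n ] (indicator (p y) * ∑[ t < T ] indicator (q t y))
    ≡⟨ sum-cong-≗ {n} (λ y → ≡.trans (cong (indicator (p y) *_) (one-class y)) (*-identityʳ _)) ⟩
  ∑[ y < n ] indicator (p y)
    ≡⟨ countFin≡∑ n p ⟨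
  countFin n p
    ∎)
  where open ≡-Reasoning

countFin-∧ˡ : ∀ n b (p : Fin n → Bool) → countFin n (λ i → b ∧ p i) ≡ indicator b * countFin n p
countFin-∧ˡ n false p = countFin-false n
countFin-∧ˡ n true  p = ≡.sym (+-identityʳ _)

countFin-∨ : ∀ n (p q : Fin n → Bool) → countFin n (λ i → p i ∨ q i) ≤ countFin n p + countFin n q
countFin-∨ n p q = begin
  countFin n (λ i → p i ∨ q i)
    ≡⟨ countFin≡∑ n _ ⟩
  ∑[ i < n ] indicator (p i ∨ q i)
    ≤⟨ ∑-mono-≤ n (λ i → indicator-∨ (p i) (q i)) ⟩
  ∑[ i < n ] (indicator (p i) + indicator (q i))
    ≡⟨ ∑-distrib-+ {n} _ _ ⟩
  ∑[ i < n ] indicator (p i) + ∑[ i < n ] indicator (q i)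
    ≡⟨ cong₂ _+_ (countFin≡∑ n p) (countFin≡∑ n q) ⟨
  countFin n p + countFin n q
    ∎
  where
  open ℕ.≤-Reasoning
  indicator-∨ : ∀ a b → indicator (a ∨ b) ≤ indicator a + indicator b
  indicator-∨ false b = ≤-refl
  indicator-∨ true  b = s≤s z≤n

countFin-anyFin : ∀ n m (f : Fin m → Fin n → Bool) →
  countFin n (λ u → anyFin m (λ w → f w u)) ≤ ∑[ w < m ] countFin n (f w)
countFin-anyFin n zero    f = ≤-reflexive (countFin-false n)
countFin-anyFin n (suc m) f = ≤-trans (countFin-∨ n (f zero) _) (+-monoʳ-≤ _ (countFin-anyFin n m (f ∘ suc)))

1≤ᵇ+ : ∀ a b → (1 ≤ᵇ a + b) ≡ (1 ≤ᵇ a) ∨ (1 ≤ᵇ b)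
1≤ᵇ+ zero    b = refl
1≤ᵇ+ (suc a) b = refl

1≤ᵇ∑ : ∀ T (f : Fin T → ℕ) → (1 ≤ᵇ ∑[ t < T ] f t) ≡ anyFin T (λ t → 1 ≤ᵇ f t)
1≤ᵇ∑ zero    f = refl
1≤ᵇ∑ (suc T) f = ≡.trans (1≤ᵇ+ (f zero) _) (cong ((1 ≤ᵇ f zero) ∨_) (1≤ᵇ∑ T (f ∘ suc)))

1≤ᵇindicator* : ∀ b x → (1 ≤ᵇ indicator b * x) ≡ b ∧ (1 ≤ᵇ x)
1≤ᵇindicator* false x = refl
1≤ᵇindicator* true  x = cong (1 ≤ᵇ_) (+-identityʳ x)

⌊⌋-true⁻ : ∀ {A : Set} (a? : Dec A) → ⌊ a? ⌋ ≡ true → A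
⌊⌋-true⁻ (yes a) _ = a

⌊⌋-true⁺ : ∀ {A : Set} (a? : Dec A) → A → ⌊ a? ⌋ ≡ true
⌊⌋-true⁺ (yes _) _ = refl
⌊⌋-true⁺ (no ¬a) a = ⊥-elim (¬a a)

-- Reachability and disjoint unions

module _ (G : Graph) where

  reach-0⁻ : ∀ v u → reach G v 0 u ≡ true → v ≡ u
  reach-0⁻ v u = ⌊⌋-true⁻ (v ≟ u)

  reach-0 : ∀ v → reach G v 0 v ≡ true
  reach-0 v = ⌊⌋-true⁺ (v ≟ v) refl

  reach-suc : ∀ v k u → reach G v k u ≡ true → reach G v (suc k) u ≡ true
  reach-suc v k u = ∨-true⁺ˡ _

  reach-step : ∀ v k w u → reach G v k w ≡ true → adj G w u ≡ true → reach G v (suc k) u ≡ true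
  reach-step v k w u vw wu =
    ∨-true⁺ʳ (reach G v k u) (anyFin⁺ (size G) (λ w′ → reach G v k w′ ∧ adj G w′ u) w (∧-true⁺ vw wu))

  reach-suc⁻ : ∀ v k u → reach G v (suc k) u ≡ true →
    reach G v k u ≡ true ⊎ ∃ λ w → reach G v k w ≡ true × adj G w u ≡ true
  reach-suc⁻ v k u e with ∨-true⁻ {reach G v k u} e
  ... | inj₁ vu   = inj₁ vu
  ... | inj₂ step = let w , vwu = anyFin⁻ (size G) _ step in inj₂ (w , ∧-true⁻ vwu)

  reach-mono : ∀ {k l} v u → k ≤ l → reach G v k u ≡ true → reach G v l u ≡ true
  reach-mono v u k≤l = go (≤⇒≤′ k≤l)
    where
    go : ∀ {k l} → k ≤′ l → reach G v k u ≡ true → reach G v l u ≡ true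
    go ≤′-refl                vu = vu
    go (≤′-step {l} k≤′l) vu = reach-suc v l u (go k≤′l vu)

  reach-refl : ∀ k v → reach G v k v ≡ true
  reach-refl k v = reach-mono v v (z≤n {k}) (reach-0 v)

  reach-trans : ∀ a b c k l → reach G a k b ≡ true → reach G b l c ≡ true → reach G a (l + k) c ≡ true
  reach-trans a b c k zero    ab bc = subst (λ x → reach G a k x ≡ true) (reach-0⁻ b c bc) ab
  reach-trans a b c k (suc l) ab bc with reach-suc⁻ b l c bc
  ... | inj₁ bc′            = reach-suc a (l + k) c (reach-trans a b c k l ab bc′)
  ... | inj₂ (w , bw , wc) = reach-step a (l + k) w c (reach-trans a b w k l ab bw) wc

  reach-sym : ∀ v u k → reach G v k u ≡ true → reach G u k v ≡ true
  reach-sym v u zero vu = subst (λ x → reach G u 0 x ≡ true) (≡.sym (reach-0⁻ v u vu)) (reach-0 u)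
  reach-sym v u (suc k) vu with reach-suc⁻ v k u vu
  ... | inj₁ vu′           = reach-suc u k v (reach-sym v u k vu′)
  ... | inj₂ (w , vw , wu) =
    subst (λ j → reach G u j v ≡ true) (+-comm k 1)
      (reach-trans u w v 1 k (reach-step u 0 u w (reach-0 u) (≡.trans (Graph.sym G u w) wu)) (reach-sym v w k vw))

module _ {G H : Graph} (e : Vertex G → Vertex H) (e-inj : Injective _≡_ _≡_ e)
         (e-adj : ∀ x y → adj H (e x) (e y) ≡ adj G x y)
         (e-closed : ∀ x z → adj H (e x) z ≡ true → ∃ λ y → e y ≡ z) where

  reach-image : ∀ a k z → reach H (e a) k z ≡ true → ∃ λ y → e y ≡ z
  reach-image a zero    z r = a , reach-0⁻ H (e a) z r
  reach-image a (suc k) z r with reach-suc⁻ H (e a) k z r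
  ... | inj₁ r′ = reach-image a k z r′
  ... | inj₂ (w , rw , wz) with reach-image a k w rw
  ... | y , refl = e-closed y z wz

  reach-embed⁺ : ∀ a k v → reach G a k v ≡ true → reach H (e a) k (e v) ≡ true
  reach-embed⁺ a zero    v r = subst (λ x → reach H (e a) 0 (e x) ≡ true) (reach-0⁻ G a v r) (reach-0 H (e a))
  reach-embed⁺ a (suc k) v r with reach-suc⁻ G a k v r
  ... | inj₁ r′            = reach-suc H (e a) k (e v) (reach-embed⁺ a k v r′)
  ... | inj₂ (w , rw , wv) = reach-step H (e a) k (e w) (e v) (reach-embed⁺ a k w rw) (≡.trans (e-adj w v) wv)

  reach-embed⁻ : ∀ a k v → reach H (e a) k (e v) ≡ true → reach G a k v ≡ true
  reach-embed⁻ a zero    v r = subst (λ x → reach G a 0 x ≡ true) (e-inj (reach-0⁻ H (e a) (e v) r)) (reach-0 G a)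
  reach-embed⁻ a (suc k) v r with reach-suc⁻ H (e a) k (e v) r
  ... | inj₁ r′ = reach-suc G a k v (reach-embed⁻ a k v r′)
  ... | inj₂ (w , rw , wv) with reach-image a k w rw
  ... | y , refl = reach-step G a k y v (reach-embed⁻ a k y rw) (≡.trans (≡.sym (e-adj y v)) wv)

adj⊎ : (G H : Graph) → Vertex G ⊎ Vertex H → Vertex G ⊎ Vertex H → Bool
adj⊎ G H (inj₁ x) (inj₁ y) = adj G x y
adj⊎ G H (inj₂ x) (inj₂ y) = adj H x y
adj⊎ G H (inj₁ _) (inj₂ _) = false
adj⊎ G H (inj₂ _) (inj₁ _) = false

adj⊎-sym : ∀ G H x y → adj⊎ G H x y ≡ adj⊎ G H y x
adj⊎-sym G H (inj₁ x) (inj₁ y) = Graph.sym G x y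
adj⊎-sym G H (inj₂ x) (inj₂ y) = Graph.sym H x y
adj⊎-sym G H (inj₁ _) (inj₂ _) = refl
adj⊎-sym G H (inj₂ _) (inj₁ _) = refl

adj⊎-irrefl : ∀ G H x → adj⊎ G H x x ≡ false
adj⊎-irrefl G H (inj₁ x) = irrefl G x
adj⊎-irrefl G H (inj₂ x) = irrefl H x

_⊕_ : Graph → Graph → Graph
G ⊕ H = record
  { size   = size G + size H
  ; adj    = λ x y → adj⊎ G H (splitAt (size G) x) (splitAt (size G) y)
  ; sym    = λ x y → adj⊎-sym G H (splitAt (size G) x) (splitAt (size G) y)
  ; irrefl = λ x → adj⊎-irrefl G H (splitAt (size G) x)
  }

module Union (G H : Graph) where

  inl : Vertex G → Vertex (G ⊕ H)
  inl v = v ↑ˡ size H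

  inr : Vertex H → Vertex (G ⊕ H)
  inr u = size G ↑ʳ u

  inl-injective : Injective _≡_ _≡_ inl
  inl-injective = ↑ˡ-injective (size H) _ _

  inr-injective : Injective _≡_ _≡_ inr
  inr-injective = ↑ʳ-injective (size G) _ _

  inl≢inr : ∀ {v u} → inl v ≢ inr u
  inl≢inr {v} {u} e with () ← ≡.trans (≡.sym (splitAt-↑ˡ (size G) v (size H)))
                                 (≡.trans (cong (splitAt (size G)) e) (splitAt-↑ʳ (size G) (size H) u))

  ⊕-view : ∀ x → (∃ λ v → inl v ≡ x) ⊎ (∃ λ u → inr u ≡ x)
  ⊕-view x with splitAt (size G) x in eq
  ... | inj₁ v = inj₁ (v , splitAt⁻¹-↑ˡ eq)
  ... | inj₂ u = inj₂ (u , splitAt⁻¹-↑ʳ eq)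

  private
    split-inl : ∀ v → splitAt (size G) (inl v) ≡ inj₁ v
    split-inl v = splitAt-↑ˡ (size G) v (size H)

    split-inr : ∀ u → splitAt (size G) (inr u) ≡ inj₂ u
    split-inr u = splitAt-↑ʳ (size G) (size H) u

  adj-inl-inl : ∀ v v′ → adj (G ⊕ H) (inl v) (inl v′) ≡ adj G v v′
  adj-inl-inl v v′ = cong₂ (adj⊎ G H) (split-inl v) (split-inl v′)

  adj-inr-inr : ∀ u u′ → adj (G ⊕ H) (inr u) (inr u′) ≡ adj H u u′
  adj-inr-inr u u′ = cong₂ (adj⊎ G H) (split-inr u) (split-inr u′)

  adj-inl-inr : ∀ v u → adj (G ⊕ H) (inl v) (inr u) ≡ false
  adj-inl-inr v u = cong₂ (adj⊎ G H) (split-inl v) (split-inr u)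

  adj-inr-inl : ∀ u v → adj (G ⊕ H) (inr u) (inl v) ≡ false
  adj-inr-inl u v = cong₂ (adj⊎ G H) (split-inr u) (split-inl v)

  private
    inl-closed : ∀ v x → adj (G ⊕ H) (inl v) x ≡ true → ∃ λ v′ → inl v′ ≡ x
    inl-closed v x vx with ⊕-view x
    ... | inj₁ found   = found
    ... | inj₂ (u , refl) with () ← ≡.trans (≡.sym vx) (adj-inl-inr v u)

    inr-closed : ∀ u x → adj (G ⊕ H) (inr u) x ≡ true → ∃ λ u′ → inr u′ ≡ x
    inr-closed u x ux with ⊕-view x
    ... | inj₂ found   = found
    ... | inj₁ (v , refl) with () ← ≡.trans (≡.sym ux) (adj-inr-inl u v)

  reach-inl⁺ : ∀ a k v → reach G a k v ≡ true → reach (G ⊕ H) (inl a) k (inl v) ≡ true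
  reach-inl⁺ = reach-embed⁺ inl inl-injective adj-inl-inl inl-closed

  reach-inl⁻ : ∀ a k v → reach (G ⊕ H) (inl a) k (inl v) ≡ true → reach G a k v ≡ true
  reach-inl⁻ = reach-embed⁻ inl inl-injective adj-inl-inl inl-closed

  reach-inr⁺ : ∀ a k u → reach H a k u ≡ true → reach (G ⊕ H) (inr a) k (inr u) ≡ true
  reach-inr⁺ = reach-embed⁺ inr inr-injective adj-inr-inr inr-closed

  reach-inr-inl : ∀ a k v → reach (G ⊕ H) (inr a) k (inl v) ≡ true → ⊥
  reach-inr-inl a k v r = let u , u≡v = reach-image {H} {G ⊕ H} inr inr-injective adj-inr-inr inr-closed a k (inl v) r
                          in inl≢inr (≡.sym u≡v)

-- Isomorphisms of neighbourhoods

InNbhd : (G : Graph) {n : ℕ} → (Fin n → Vertex G) → ℕ → Vertex G → Set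
InNbhd G a r v = ∃ λ i → reach G (a i) r v ≡ true

record NbhdIso (G H : Graph) {n : ℕ} (a : Fin n → Vertex G) (b : Fin n → Vertex H) (r : ℕ) : Set₁ where
  field
    rel        : Vertex G → Vertex H → Set
    dom        : ∀ {v w} → rel v w → InNbhd G a r v
    cod        : ∀ {v w} → rel v w → InNbhd H b r w
    total      : ∀ v → InNbhd G a r v → ∃ λ w → rel v w
    onto       : ∀ w → InNbhd H b r w → ∃ λ v → rel v w
    functional : ∀ {v w w′} → rel v w → rel v w′ → w ≡ w′
    injective  : ∀ {v v′ w} → rel v w → rel v′ w → v ≡ v′
    roots      : ∀ i → rel (a i) (b i)
    adj-rel    : ∀ {v v′ w w′} → rel v w → rel v′ w′ → adj G v v′ ≡ adj H w w′

open NbhdIso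

Query : ℕ → Set
Query n = (G : Graph) → (Fin n → Vertex G) → Bool

Local : ∀ {n} {X : Set} → ℕ → ((G : Graph) → (Fin n → Vertex G) → X) → Set₁
Local r F = ∀ {G H a b} → NbhdIso G H a b r → F G a ≡ F H b

iso-sym : ∀ {G H n} {a : Fin n → Vertex G} {b : Fin n → Vertex H} {r} → NbhdIso G H a b r → NbhdIso H G b a r
iso-sym P = record
  { rel = λ w v → rel P v w ; dom = cod P ; cod = dom P ; total = onto P ; onto = total P
  ; functional = injective P ; injective = functional P ; roots = roots P
  ; adj-rel = λ vw v′w′ → ≡.sym (adj-rel P vw v′w′) }

iso-empty : ∀ {G H} {a : Fin 0 → Vertex G} {b : Fin 0 → Vertex H} {r} → NbhdIso G H a b r
iso-empty = record
  { rel = λ _ _ → ⊥ ; dom = λ () ; cod = λ () ; total = λ _ → λ { (() , _) } ; onto = λ _ → λ { (() , _) }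
  ; functional = λ () ; injective = λ () ; roots = λ () ; adj-rel = λ () }

reach-transport : ∀ {G H n} {a : Fin n → Vertex G} {b : Fin n → Vertex H} {r} (P : NbhdIso G H a b r) →
  ∀ {c c′} → rel P c c′ → ∀ k → (∀ u → reach G c k u ≡ true → InNbhd G a r u) →
  ∀ {v w} → rel P v w → reach G c k v ≡ true → reach H c′ k w ≡ true
reach-transport {G} {H} P {c} {c′} cc′ zero inside {v} {w} vw cv =
  subst (λ x → reach H c′ 0 x ≡ true)
        (functional P cc′ (subst (λ x → rel P x w) (≡.sym (reach-0⁻ G c v cv)) vw)) (reach-0 H c′)
reach-transport {G} {H} {a = a} {r = r} P {c} {c′} cc′ (suc k) inside {v} {w} vw cv = step (reach-suc⁻ G c k v cv)
  where
  inside′ : ∀ u → reach G c k u ≡ true → InNbhd G a r u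
  inside′ u cu = inside u (reach-suc G c k u cu)
  step : reach G c k v ≡ true ⊎ ∃ (λ u → reach G c k u ≡ true × adj G u v ≡ true) → reach H c′ (suc k) w ≡ true
  step (inj₁ cv′)           = reach-suc H c′ k w (reach-transport P cc′ k inside′ vw cv′)
  step (inj₂ (u , cu , uv)) =
    let u′ , uu′ = total P u (inside′ u cu) in
    reach-step H c′ k u′ w (reach-transport P cc′ k inside′ uu′ cu) (≡.trans (≡.sym (adj-rel P uu′ vw)) uv)

iso-restrict : ∀ {G H n} {a : Fin n → Vertex G} {b : Fin n → Vertex H} {r r′} →
  r′ ≤ r → NbhdIso G H a b r → NbhdIso G H a b r′
iso-restrict {G} {H} {a = a} {b} {r} {r′} r′≤r P = record
  { rel = λ v w → rel P v w × InNbhd G a r′ v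
  ; dom = proj₂
  ; cod = λ { (vw , i , e) → i , reach-transport P (roots P i) r′ (insideG i) vw e }
  ; total = λ { v (i , e) → let w , vw = total P v (i , reach-mono G (a i) v r′≤r e) in w , vw , i , e }
  ; onto = λ { w (i , e) → let v , vw = onto P w (i , reach-mono H (b i) w r′≤r e) in
                 v , vw , i , reach-transport (iso-sym P) (roots P i) r′ (insideH i) vw e }
  ; functional = λ x y → functional P (proj₁ x) (proj₁ y)
  ; injective = λ x y → injective P (proj₁ x) (proj₁ y)
  ; roots = λ i → roots P i , i , reach-refl G r′ (a i)
  ; adj-rel = λ x y → adj-rel P (proj₁ x) (proj₁ y) }
  where
  insideG : ∀ i u → reach G (a i) r′ u ≡ true → InNbhd G a r u
  insideG i u e = i , reach-mono G (a i) u r′≤r e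
  insideH : ∀ i u → reach H (b i) r′ u ≡ true → InNbhd H b r u
  insideH i u e = i , reach-mono H (b i) u r′≤r e

local-mono : ∀ {n r r′} {F : Query n} → r ≤ r′ → Local r F → Local r′ F
local-mono r≤r′ F-local P = F-local (iso-restrict r≤r′ P)

-- Beyond distance 2r+1 the r-balls of two vertices are disjoint and joined by no edge.
near-radius : ℕ → ℕ
near-radius r = suc (r + r)

step-radius : ℕ → ℕ
step-radius r = r + near-radius r

module _ {G H : Graph} {n} {a : Fin n → Vertex G} {b : Fin n → Vertex H} (r : ℕ)
         (P : NbhdIso G H a b (step-radius r)) where

  private
    near-inside : ∀ {G} {a : Fin n → Vertex G} {y} → InNbhd G a (near-radius r) y →
      ∀ v → InNbhd G (extend a y) r v → InNbhd G a (step-radius r) v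
    near-inside {G} {a} {y} (i , ay) v (zero  , yv) = i , reach-trans G (a i) y v (near-radius r) r ay yv
    near-inside {G} {a} {y} (i , ay) v (suc j , av) = j , reach-mono G (a j) v (m≤m+n r (near-radius r)) av

    transport-from : ∀ j u → reach G (a j) (near-radius r) u ≡ true → InNbhd G a (step-radius r) u
    transport-from j u e = j , reach-mono G (a j) u (m≤n+m (near-radius r) r) e

  near-transport : ∀ {y w} → rel P y w → InNbhd G a (near-radius r) y → InNbhd H b (near-radius r) w
  near-transport yw (i , ay) = i , reach-transport P (roots P i) (near-radius r) (transport-from i) yw ay

  iso-extend-near : ∀ {y w} → rel P y w → InNbhd G a (near-radius r) y →
    NbhdIso G H (extend a y) (extend b w) r
  iso-extend-near {y} {w} yw y-near = record
    { rel = λ v v′ → rel P v v′ × InNbhd G (extend a y) r v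
    ; dom = proj₂
    ; cod = λ { (vv′ , nb) → transport-nbhd P yw y-near vv′ nb }
    ; total = λ v nb → let v′ , vv′ = total P v (near-inside y-near v nb) in v′ , vv′ , nb
    ; onto = λ v′ nb → let v , vv′ = onto P v′ (near-inside w-near v′ nb) in
                         v , vv′ , transport-nbhd (iso-sym P) yw w-near vv′ nb
    ; functional = λ x y → functional P (proj₁ x) (proj₁ y)
    ; injective = λ x y → injective P (proj₁ x) (proj₁ y)
    ; roots = λ { zero → yw , zero , reach-refl G r y ; (suc i) → roots P i , suc i , reach-refl G r (a i) }
    ; adj-rel = λ x y → adj-rel P (proj₁ x) (proj₁ y) }
    where
    w-near = near-transport yw y-near
    transport-nbhd : ∀ {G H} {a : Fin n → Vertex G} {b : Fin n → Vertex H} (Q : NbhdIso G H a b (step-radius r)) →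
      ∀ {y w} → rel Q y w → InNbhd G a (near-radius r) y →
      ∀ {v v′} → rel Q v v′ → InNbhd G (extend a y) r v → InNbhd H (extend b w) r v′
    transport-nbhd Q yw y-near vv′ (zero , yv) =
      zero , reach-transport Q yw r (λ u yu → near-inside y-near u (zero , yu)) vv′ yv
    transport-nbhd {G} {a = a} Q yw y-near vv′ (suc j , av) =
      suc j , reach-transport Q (roots Q j) r (λ u au → j , reach-mono G (a j) u (m≤m+n r (near-radius r)) au) vv′ av

WithinRadius : ℕ → RootedGraph → Set
WithinRadius r σ = ∀ u → reach (graph σ) (root σ) r u ≡ true

attach : ∀ G {n} → (Fin n → Vertex G) → (σ : RootedGraph) → Fin (suc n) → Vertex (G ⊕ graph σ)
attach G a σ = extend (inl ∘ a) (inr (root σ))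
  where open Union G (graph σ)

module _ (G : Graph) {n} (a : Fin n → Vertex G) (σ : RootedGraph) (r : ℕ) where

  open Union G (graph σ)

  nbhd-inl⁺ : ∀ {v} → InNbhd G a r v → InNbhd (G ⊕ graph σ) (attach G a σ) r (inl v)
  nbhd-inl⁺ {v} (i , av) = suc i , reach-inl⁺ (a i) r v av

  nbhd-inl⁻ : ∀ {v} → InNbhd (G ⊕ graph σ) (attach G a σ) r (inl v) → InNbhd G a r v
  nbhd-inl⁻ {v} (zero  , σv) = ⊥-elim (reach-inr-inl (root σ) r v σv)
  nbhd-inl⁻ {v} (suc i , av) = i , reach-inl⁻ (a i) r v av

  nbhd-inr : WithinRadius r σ → ∀ u → InNbhd (G ⊕ graph σ) (attach G a σ) r (inr u)
  nbhd-inr σ-within u = zero , reach-inr⁺ (root σ) r u (σ-within u)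

  iso-extend-far : ∀ {y} → ¬ InNbhd G a (near-radius r) y → WithinRadius r σ → HasBallType G y r σ →
    NbhdIso G (G ⊕ graph σ) (extend a y) (attach G a σ) r
  iso-extend-far {y} y-far σ-within (f , f-inj , f-root , f-reach , f-onto , f-adj) = record
    { rel = Rel
    ; dom = λ { (inj₁ (nb , _)) → suc (proj₁ nb) , proj₂ nb ; (inj₂ (u , refl , _)) → zero , f-reach u }
    ; cod = λ { (inj₁ (nb , refl)) → nbhd-inl⁺ nb ; (inj₂ (u , _ , refl)) → nbhd-inr σ-within u }
    ; total = λ { v (zero , yv) → let u , fu = f-onto v yv in inr u , inj₂ (u , fu , refl)
                ; v (suc i , av) → inl v , inj₁ ((i , av) , refl) }
    ; onto = onto′
    ; functional = functional′
    ; injective = injective′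
    ; roots = λ { zero → inj₂ (root σ , f-root , refl) ; (suc i) → inj₁ ((i , reach-refl G r (a i)) , refl) }
    ; adj-rel = adj-rel′ }
    where
    S = graph σ
    Rel : Vertex G → Vertex (G ⊕ S) → Set
    Rel v x = (InNbhd G a r v × inl v ≡ x) ⊎ (∃ λ u → f u ≡ v × inr u ≡ x)

    disjoint : ∀ {v} → InNbhd G a r v → reach G y r v ≡ true → ⊥
    disjoint {v} (i , av) yv =
      y-far (i , reach-mono G (a i) y (n≤1+n (r + r)) (reach-trans G (a i) v y r r av (reach-sym G y v r yv)))

    non-adjacent : ∀ {v v′} → InNbhd G a r v → reach G y r v′ ≡ true → adj G v v′ ≡ false
    non-adjacent {v} {v′} (i , av) yv′ with adj G v v′ in vv′
    ... | false = refl
    ... | true  = ⊥-elim (y-far (i , subst (λ k → reach G (a i) k y ≡ true) (+-suc r r)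
                    (reach-trans G (a i) v′ y (suc r) r (reach-step G (a i) r v v′ av vv′) (reach-sym G y v′ r yv′))))

    onto′ : ∀ x → InNbhd (G ⊕ S) (attach G a σ) r x → ∃ λ v → Rel v x
    onto′ x nb with ⊕-view x
    ... | inj₁ (v , refl) = v , inj₁ (nbhd-inl⁻ nb , refl)
    ... | inj₂ (u , refl) = f u , inj₂ (u , refl , refl)

    functional′ : ∀ {v x x′} → Rel v x → Rel v x′ → x ≡ x′
    functional′ (inj₁ (_ , refl)) (inj₁ (_ , refl))           = refl
    functional′ (inj₁ (nb , _)) (inj₂ (u , refl , _))          = ⊥-elim (disjoint nb (f-reach u))
    functional′ (inj₂ (u , refl , _)) (inj₁ (nb , _))          = ⊥-elim (disjoint nb (f-reach u))
    functional′ (inj₂ (u , fu , refl)) (inj₂ (u′ , fu′ , refl)) = cong inr (f-inj (≡.trans fu (≡.sym fu′)))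

    injective′ : ∀ {v v′ x} → Rel v x → Rel v′ x → v ≡ v′
    injective′ (inj₁ (_ , e)) (inj₁ (_ , e′))                 = inl-injective (≡.trans e (≡.sym e′))
    injective′ (inj₁ (_ , e)) (inj₂ (_ , _ , e′))             = ⊥-elim (inl≢inr (≡.trans e (≡.sym e′)))
    injective′ (inj₂ (_ , _ , e)) (inj₁ (_ , e′))             = ⊥-elim (inl≢inr (≡.trans e′ (≡.sym e)))
    injective′ (inj₂ (u , refl , e)) (inj₂ (u′ , refl , e′)) = cong f (inr-injective (≡.trans e (≡.sym e′)))

    adj-rel′ : ∀ {v v′ x x′} → Rel v x → Rel v′ x′ → adj G v v′ ≡ adj (G ⊕ S) x x′
    adj-rel′ {v} {v′} (inj₁ (_ , refl)) (inj₁ (_ , refl)) = ≡.sym (adj-inl-inl v v′)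
    adj-rel′ (inj₂ (u , refl , refl)) (inj₂ (u′ , refl , refl)) = ≡.trans (f-adj u u′) (≡.sym (adj-inr-inr u u′))
    adj-rel′ {v} (inj₁ (nb , refl)) (inj₂ (u′ , refl , refl)) =
      ≡.trans (non-adjacent nb (f-reach u′)) (≡.sym (adj-inl-inr v u′))
    adj-rel′ {_} {v′} (inj₂ (u , refl , refl)) (inj₁ (nb , refl)) =
      ≡.trans (Graph.sym G (f u) v′) (≡.trans (non-adjacent nb (f-reach u)) (≡.sym (adj-inr-inl u v′)))

iso-⊕ : ∀ {G H n} {a : Fin n → Vertex G} {b : Fin n → Vertex H} {r} (σ : RootedGraph) → WithinRadius r σ →
  NbhdIso G H a b r → NbhdIso (G ⊕ graph σ) (H ⊕ graph σ) (attach G a σ) (attach H b σ) r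
iso-⊕ {G} {H} {n} {a} {b} {r} σ σ-within P = record
  { rel = Rel
  ; dom = λ { (inj₁ (v , w , refl , refl , vw)) → nbhd-inl⁺ G a σ r (dom P vw)
            ; (inj₂ (u , refl , refl)) → nbhd-inr G a σ r σ-within u }
  ; cod = λ { (inj₁ (v , w , refl , refl , vw)) → nbhd-inl⁺ H b σ r (cod P vw)
            ; (inj₂ (u , refl , refl)) → nbhd-inr H b σ r σ-within u }
  ; total = total′
  ; onto = onto′
  ; functional = functional′
  ; injective = injective′
  ; roots = λ { zero → inj₂ (root σ , refl , refl) ; (suc i) → inj₁ (a i , b i , refl , refl , roots P i) }
  ; adj-rel = adj-rel′ }
  where
  S = graph σ
  module GS = Union G S
  module HS = Union H S
  Rel : Vertex (G ⊕ S) → Vertex (H ⊕ S) → Set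
  Rel x x′ = (∃ λ v → ∃ λ w → GS.inl v ≡ x × HS.inl w ≡ x′ × rel P v w) ⊎ (∃ λ u → GS.inr u ≡ x × HS.inr u ≡ x′)

  total′ : ∀ x → InNbhd (G ⊕ S) (attach G a σ) r x → ∃ λ x′ → Rel x x′
  total′ x nb with GS.⊕-view x
  ... | inj₁ (v , refl) = let w , vw = total P v (nbhd-inl⁻ G a σ r nb) in HS.inl w , inj₁ (v , w , refl , refl , vw)
  ... | inj₂ (u , refl) = HS.inr u , inj₂ (u , refl , refl)

  onto′ : ∀ x′ → InNbhd (H ⊕ S) (attach H b σ) r x′ → ∃ λ x → Rel x x′
  onto′ x′ nb with HS.⊕-view x′
  ... | inj₁ (w , refl) = let v , vw = onto P w (nbhd-inl⁻ H b σ r nb) in GS.inl v , inj₁ (v , w , refl , refl , vw)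
  ... | inj₂ (u , refl) = GS.inr u , inj₂ (u , refl , refl)

  functional′ : ∀ {x y y′} → Rel x y → Rel x y′ → y ≡ y′
  functional′ (inj₁ (v , w , refl , refl , vw)) (inj₁ (v′ , w′ , e , refl , v′w′))
    with refl ← GS.inl-injective e = cong HS.inl (functional P vw v′w′)
  functional′ (inj₁ (_ , _ , e , _ , _)) (inj₂ (_ , e′ , _)) = ⊥-elim (GS.inl≢inr (≡.trans e (≡.sym e′)))
  functional′ (inj₂ (_ , e , _)) (inj₁ (_ , _ , e′ , _ , _)) = ⊥-elim (GS.inl≢inr (≡.trans e′ (≡.sym e)))
  functional′ (inj₂ (u , refl , refl)) (inj₂ (u′ , e , refl)) = cong HS.inr (GS.inr-injective (≡.sym e))

  injective′ : ∀ {x x′ y} → Rel x y → Rel x′ y → x ≡ x′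
  injective′ (inj₁ (v , w , refl , refl , vw)) (inj₁ (v′ , w′ , refl , e , v′w′))
    with refl ← HS.inl-injective e = cong GS.inl (injective P vw v′w′)
  injective′ (inj₁ (_ , _ , _ , e , _)) (inj₂ (_ , _ , e′)) = ⊥-elim (HS.inl≢inr (≡.trans e (≡.sym e′)))
  injective′ (inj₂ (_ , _ , e)) (inj₁ (_ , _ , _ , e′ , _)) = ⊥-elim (HS.inl≢inr (≡.trans e′ (≡.sym e)))
  injective′ (inj₂ (u , refl , refl)) (inj₂ (u′ , refl , e)) = cong GS.inr (HS.inr-injective (≡.sym e))

  adj-rel′ : ∀ {x x′ y y′} → Rel x y → Rel x′ y′ → adj (G ⊕ S) x x′ ≡ adj (H ⊕ S) y y′
  adj-rel′ (inj₁ (v , w , refl , refl , vw)) (inj₁ (v′ , w′ , refl , refl , v′w′)) =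
    ≡.trans (GS.adj-inl-inl v v′) (≡.trans (adj-rel P vw v′w′) (≡.sym (HS.adj-inl-inl w w′)))
  adj-rel′ (inj₂ (u , refl , refl)) (inj₂ (u′ , refl , refl)) =
    ≡.trans (GS.adj-inr-inr u u′) (≡.sym (HS.adj-inr-inr u u′))
  adj-rel′ (inj₁ (v , w , refl , refl , _)) (inj₂ (u′ , refl , refl)) =
    ≡.trans (GS.adj-inl-inr v u′) (≡.sym (HS.adj-inl-inr w u′))
  adj-rel′ (inj₂ (u , refl , refl)) (inj₁ (v′ , w′ , refl , refl , _)) =
    ≡.trans (GS.adj-inr-inl u v′) (≡.sym (HS.adj-inr-inl u w′))


-- Ball types

Σ-Fin⇒Fin? : ∀ m n (P : (Fin m → Fin n) → Set) → (∀ {f g} → f ≗ g → P f → P g) →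
  (∀ f → Dec (P f)) → Dec (Σ (Fin m → Fin n) P)
Σ-Fin⇒Fin? zero    n P resp P? = map′ (_ ,_) (λ (f , pf) → resp (λ ()) pf) (P? (λ ()))
Σ-Fin⇒Fin? (suc m) n P resp P? =
  map′ (λ (x , g , p) → x Vector.∷ g , p)
       (λ (f , p) → f zero , f ∘ suc , resp (λ { zero → refl ; (suc i) → refl }) p)
       (any? λ x → Σ-Fin⇒Fin? m n (P ∘ (x Vector.∷_)) (λ f≗g → resp (λ { zero → refl ; (suc i) → f≗g i })) (P? ∘ (x Vector.∷_)))

module _ (G : Graph) (v : Vertex G) (r : ℕ) (τ : RootedGraph) where

  private
    IsBallMap : (Vertex (graph τ) → Vertex G) → Set
    IsBallMap f =
      Injective _≡_ _≡_ f × (f (root τ) ≡ v) × (∀ w → reach G v r (f w) ≡ true) ×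
      (∀ u → reach G v r u ≡ true → ∃ λ w → f w ≡ u) × (∀ w w′ → adj G (f w) (f w′) ≡ adj (graph τ) w w′)

    resp : ∀ {f g} → f ≗ g → IsBallMap f → IsBallMap g
    resp {f} {g} f≗g (f-inj , f-root , f-reach , f-onto , f-adj) =
        (λ {x} {y} e → f-inj (≡.trans (f≗g x) (≡.trans e (≡.sym (f≗g y)))))
      , ≡.trans (≡.sym (f≗g (root τ))) f-root
      , (λ w → subst (λ x → reach G v r x ≡ true) (f≗g w) (f-reach w))
      , (λ u vu → let w , fw = f-onto u vu in w , ≡.trans (≡.sym (f≗g w)) fw)
      , (λ w w′ → ≡.trans (cong₂ (adj G) (≡.sym (f≗g w)) (≡.sym (f≗g w′))) (f-adj w w′))

    isBallMap? : ∀ f → Dec (IsBallMap f)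
    isBallMap? f =
      map′ (λ h {x} {y} → h x y) (λ h x y → h) (all? λ x → all? λ y → (f x ≟ f y) →-dec (x ≟ y))
      ×-dec (f (root τ) ≟ v)
      ×-dec (all? λ w → reach G v r (f w) Bool.≟ true)
      ×-dec (all? λ u → (reach G v r u Bool.≟ true) →-dec any? (λ w → f w ≟ u))
      ×-dec (all? λ w → all? λ w′ → adj G (f w) (f w′) Bool.≟ adj (graph τ) w w′)

  hasBallType? : Dec (HasBallType G v r τ)
  hasBallType? = Σ-Fin⇒Fin? (size (graph τ)) (size G) IsBallMap resp isBallMap?

hasBallTypeᵇ : (G : Graph) → Vertex G → ℕ → RootedGraph → Bool
hasBallTypeᵇ G v r τ = ⌊ hasBallType? G v r τ ⌋

typeCount : Graph → ℕ → RootedGraph → ℕ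
typeCount G r τ = countFin (size G) (λ x → hasBallTypeᵇ G x r τ)

module _ (G : Graph) (r : ℕ) (τ : RootedGraph) where

  private
    sound : ∀ x → hasBallTypeᵇ G x r τ ≡ true → HasBallType G x r τ
    sound x = ⌊⌋-true⁻ (hasBallType? G x r τ)

    complete : ∀ x → HasBallType G x r τ → hasBallTypeᵇ G x r τ ≡ true
    complete x = ⌊⌋-true⁺ (hasBallType? G x r τ)

  exactly⇔ : ∀ m → Exactly G m r τ ⇔ (typeCount G r τ ≡ m)
  exactly⇔ m = mk⇔
    (λ e → enumeration⇒countFin≡ (size G) _ (map₂ (map₂ (Product.map (complete _ ∘_) (λ onto x → onto x ∘ sound x))) e))
    (λ { refl → map₂ (map₂ (Product.map (sound _ ∘_) (λ onto x → onto x ∘ complete x)))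
                      (enumerate (size G) (λ x → hasBallTypeᵇ G x r τ)) })

  atLeast⇔ : ∀ m → AtLeast G m r τ ⇔ (m ≤ typeCount G r τ)
  atLeast⇔ m = mk⇔
    (injection⇒≤countFin (size G) _ ∘ map₂ (map₂ (complete _ ∘_)))
    (map₂ (map₂ (sound _ ∘_)) ∘ ≤countFin⇒injection (size G) _)

  countMod⇔ : ∀ j ℓ → CountMod G j ℓ r τ ⇔ CongMod (typeCount G r τ) j ℓ
  countMod⇔ j ℓ = mk⇔
    (λ (m , exactly-m , m≡j) → subst (λ c → CongMod c j ℓ) (≡.sym (Equivalence.to (exactly⇔ m) exactly-m)) m≡j)
    (λ c≡j → typeCount G r τ , Equivalence.from (exactly⇔ _) refl , c≡j)

hasBallType-transport : ∀ {G H n} {a : Fin n → Vertex G} {b : Fin n → Vertex H} {r} →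
  NbhdIso G H a b r → ∀ i τ → HasBallType G (a i) r τ → HasBallType H (b i) r τ
hasBallType-transport {G} {H} {a = a} {b} {r} P i τ (f , f-inj , f-root , f-reach , f-onto , f-adj) =
  f′ , f′-inj , f′-root , f′-reach , f′-onto , f′-adj
  where
  in-ball : ∀ {G} {a : Fin _ → Vertex G} u → reach G (a i) r u ≡ true → InNbhd G a r u
  in-ball u e = i , e
  related : ∀ w → ∃ λ x → rel P (f w) x
  related w = total P (f w) (i , f-reach w)
  f′ = λ w → proj₁ (related w)
  f′-rel = λ w → proj₂ (related w)
  f′-inj : Injective _≡_ _≡_ f′
  f′-inj {x} {y} e = f-inj (injective P (f′-rel x) (subst (rel P (f y)) (≡.sym e) (f′-rel y)))
  f′-root : f′ (root τ) ≡ b i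
  f′-root = functional P (f′-rel (root τ)) (subst (λ z → rel P z (b i)) (≡.sym f-root) (roots P i))
  f′-reach : ∀ w → reach H (b i) r (f′ w) ≡ true
  f′-reach w = reach-transport P (roots P i) r in-ball (f′-rel w) (f-reach w)
  f′-onto : ∀ u → reach H (b i) r u ≡ true → ∃ λ w → f′ w ≡ u
  f′-onto u bu =
    let v , vu = onto P u (i , bu)
        w , fw = f-onto v (reach-transport (iso-sym P) (roots P i) r in-ball vu bu)
    in w , functional P (f′-rel w) (subst (λ z → rel P z u) (≡.sym fw) vu)
  f′-adj : ∀ w w′ → adj H (f′ w) (f′ w′) ≡ adj (graph τ) w w′
  f′-adj w w′ = ≡.trans (≡.sym (adj-rel P (f′-rel w) (f′-rel w′))) (f-adj w w′)

hasBallTypeᵇ-local : ∀ {G H n} {a : Fin n → Vertex G} {b : Fin n → Vertex H} {r} →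
  NbhdIso G H a b r → ∀ i τ → hasBallTypeᵇ G (a i) r τ ≡ hasBallTypeᵇ H (b i) r τ
hasBallTypeᵇ-local {G} {H} {a = a} {b} {r} P i τ = true⇔⇒≡
  (⌊⌋-true⁺ (hasBallType? H (b i) r τ) ∘ hasBallType-transport P i τ ∘ ⌊⌋-true⁻ (hasBallType? G (a i) r τ))
  (⌊⌋-true⁺ (hasBallType? G (a i) r τ) ∘ hasBallType-transport (iso-sym P) i τ ∘ ⌊⌋-true⁻ (hasBallType? H (b i) r τ))

hasBallType-∘ : ∀ G y r σ σ′ → WithinRadius r σ′ →
  HasBallType (graph σ′) (root σ′) r σ → HasBallType G y r σ′ → HasBallType G y r σ
hasBallType-∘ G y r σ σ′ σ′-within (f , f-inj , f-root , f-reach , f-onto , f-adj) (g , g-inj , g-root , g-reach , g-onto , g-adj) =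
  g ∘ f , f-inj ∘ g-inj , ≡.trans (cong g f-root) g-root , g-reach ∘ f , g∘f-onto , λ w w′ → ≡.trans (g-adj (f w) (f w′)) (f-adj w w′)
  where
  g∘f-onto : ∀ u → reach G y r u ≡ true → ∃ λ w → g (f w) ≡ u
  g∘f-onto u yu = let w′ , gw′ = g-onto u yu
                      w , fw = f-onto w′ (σ′-within w′)
                  in w , ≡.trans (cong g fw) gw′

hasBallType-unique : ∀ G y r σ σ′ → WithinRadius r σ′ →
  HasBallType G y r σ → HasBallType G y r σ′ → HasBallType (graph σ′) (root σ′) r σ
hasBallType-unique G y r σ σ′ σ′-within (f , f-inj , f-root , f-reach , f-onto , f-adj) (g , g-inj , g-root , g-reach , g-onto , g-adj) =
  h , h-inj , h-root , σ′-within ∘ h , h-onto , h-adj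
  where
  h = λ w → proj₁ (g-onto (f w) (f-reach w))
  g∘h : ∀ w → g (h w) ≡ f w
  g∘h w = proj₂ (g-onto (f w) (f-reach w))
  h-inj : Injective _≡_ _≡_ h
  h-inj {x} {y} e = f-inj (≡.trans (≡.sym (g∘h x)) (≡.trans (cong g e) (g∘h y)))
  h-root : h (root σ) ≡ root σ′
  h-root = g-inj (≡.trans (g∘h (root σ)) (≡.trans f-root (≡.sym g-root)))
  h-onto : ∀ u → reach (graph σ′) (root σ′) r u ≡ true → ∃ λ w → h w ≡ u
  h-onto u _ = let w , fw = f-onto (g u) (g-reach u) in w , g-inj (≡.trans (g∘h w) fw)
  h-adj : ∀ w w′ → adj (graph σ′) (h w) (h w′) ≡ adj (graph σ) w w′
  h-adj w w′ = ≡.trans (≡.sym (g-adj (h w) (h w′))) (≡.trans (cong₂ (adj G) (g∘h w) (g∘h w′)) (f-adj w w′))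

∑-const : ∀ n c → ∑[ i < n ] c ≡ n * c
∑-const zero    c = refl
∑-const (suc n) c = cong (c +_) (∑-const n c)

module _ {d} (G : Graph) (G-deg : MaxDeg≤ G d) where

  ball-size : ∀ v k → countFin (size G) (reach G v k) ≤ suc d ^ k
  ball-size v zero =
    countFin-≤-via (reach G v 0) (λ (_ : Fin 1) → true) (λ x _ → x ≡ v)
      (λ x vx → zero , ≡.sym (reach-0⁻ G v x vx) , refl) (λ x≡v x′≡v → ≡.trans x≡v (≡.sym x′≡v))
  ball-size v (suc k) = begin
    countFin n (reach G v (suc k))
      ≤⟨ countFin-∨ n _ _ ⟩
    B + countFin n (λ u → anyFin n (λ w → reach G v k w ∧ adj G w u))
      ≤⟨ +-monoʳ-≤ B (countFin-anyFin n n _) ⟩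
    B + ∑[ w < n ] countFin n (λ u → reach G v k w ∧ adj G w u)
      ≡⟨ cong (B +_) (sum-cong-≗ {n} (λ w → countFin-∧ˡ n (reach G v k w) (adj G w))) ⟩
    B + ∑[ w < n ] (indicator (reach G v k w) * degree G w)
      ≤⟨ +-monoʳ-≤ B (∑-mono-≤ n (λ w → *-monoʳ-≤ (indicator (reach G v k w)) (G-deg w))) ⟩
    B + ∑[ w < n ] (indicator (reach G v k w) * d)
      ≡⟨ cong (B +_) (*-distribʳ-sum {n} d (λ w → indicator (reach G v k w))) ⟨
    B + (∑[ w < n ] indicator (reach G v k w)) * d
      ≡⟨ cong (λ c → B + c * d) (countFin≡∑ n (reach G v k)) ⟨
    B + B * d
      ≡⟨ *-suc B d ⟨
    B * suc d
      ≤⟨ *-monoˡ-≤ (suc d) (ball-size v k) ⟩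
    suc d ^ k * suc d
      ≡⟨ *-comm (suc d ^ k) (suc d) ⟩
    suc d ^ suc k
      ∎
    where
    open ℕ.≤-Reasoning
    n = size G
    B = countFin n (reach G v k)

  nbhd-size : ∀ {n} (a : Fin n → Vertex G) k →
    countFin (size G) (λ y → anyFin n (λ i → reach G (a i) k y)) ≤ n * suc d ^ k
  nbhd-size {n} a k = begin
    countFin (size G) (λ y → anyFin n (λ i → reach G (a i) k y))
      ≤⟨ countFin-anyFin (size G) n (λ i → reach G (a i) k) ⟩
    ∑[ i < n ] countFin (size G) (reach G (a i) k)
      ≤⟨ ∑-mono-≤ n (λ i → ball-size (a i) k) ⟩
    ∑[ i < n ] (suc d ^ k)
      ≡⟨ ∑-const n (suc d ^ k) ⟩
    n * suc d ^ k
      ∎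
    where open ℕ.≤-Reasoning

allFunctions : ∀ {A : Set} m → List A → List (Fin m → A)
allFunctions zero    xs = [ (λ ()) ]
allFunctions (suc m) xs = cartesianProductWith Vector._∷_ xs (allFunctions m xs)

allFunctions-complete : ∀ {A : Set} (E : A → A → Set) m xs → (∀ x → Any (E x) xs) →
  ∀ (f : Fin m → A) → Any (λ g → ∀ i → E (f i) (g i)) (allFunctions m xs)
allFunctions-complete E zero    xs xs-complete f = here (λ ())
allFunctions-complete E (suc m) xs xs-complete f =
  Anyₚ.cartesianProductWith⁺ Vector._∷_ (λ e₀ e → λ { zero → e₀ ; (suc i) → e i })
    (xs-complete (f zero)) (allFunctions-complete E m xs xs-complete (f ∘ suc))

bools : List Bool
bools = true ∷ false ∷ []

bools-complete : ∀ b → Any (b ≡_) bools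
bools-complete true  = here refl
bools-complete false = there (here refl)

graphsWithAdjacency : ∀ m → (Fin m → Fin m → Bool) → List Graph
graphsWithAdjacency m A with all? (λ u → all? λ v → A u v Bool.≟ A v u) | all? (λ v → A v v Bool.≟ false)
... | yes A-sym | yes A-irrefl = [ record { size = m ; adj = A ; sym = A-sym ; irrefl = A-irrefl } ]
... | _         | _            = []

graphsWithAdjacency-complete : ∀ m A (P : Graph → Set) →
  (∀ u v → A u v ≡ A v u) → (∀ v → A v v ≡ false) →
  (∀ A-sym A-irrefl → P (record { size = m ; adj = A ; sym = A-sym ; irrefl = A-irrefl })) →
  Any P (graphsWithAdjacency m A)
graphsWithAdjacency-complete m A P A-sym A-irrefl P-A
  with all? (λ u → all? λ v → A u v Bool.≟ A v u) | all? (λ v → A v v Bool.≟ false)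
... | yes s | yes i = here (P-A s i)
... | no ¬s | _     = ⊥-elim (¬s A-sym)
... | yes _ | no ¬i = ⊥-elim (¬i A-irrefl)

rootedGraphsOfSize : ℕ → List RootedGraph
rootedGraphsOfSize m =
  concatMap (λ A → concatMap (λ G → map (rooted G) (allFin (size G))) (graphsWithAdjacency m A))
            (allFunctions m (allFunctions m bools))

rootedGraphsOfSize-complete : ∀ m (P : RootedGraph → Set) (A : Fin m → Fin m → Bool) →
  (∀ u v → A u v ≡ A v u) → (∀ v → A v v ≡ false) → (ρ : Fin m) →
  (∀ A′ → (∀ u v → A′ u v ≡ A u v) → ∀ A′-sym A′-irrefl →
     P (rooted (record { size = m ; adj = A′ ; sym = A′-sym ; irrefl = A′-irrefl }) ρ)) →
  Any P (rootedGraphsOfSize m)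
rootedGraphsOfSize-complete m P A A-sym A-irrefl ρ P-A =
  Anyₚ.concatMap⁺ _ (Any.map found (allFunctions-complete _≗_ m _
    (allFunctions-complete _≡_ m bools bools-complete) A))
  where
  found : ∀ {A′} → (∀ u → A u ≗ A′ u) → Any P (concatMap (λ G → map (rooted G) (allFin (size G))) (graphsWithAdjacency m A′))
  found {A′} A≗A′ = Anyₚ.concatMap⁺ _ (graphsWithAdjacency-complete m A′ _
    (λ u v → ≡.trans (≡.sym (A≗A′ u v)) (≡.trans (A-sym u v) (A≗A′ v u)))
    (λ v → ≡.trans (≡.sym (A≗A′ v v)) (A-irrefl v))
    (λ s i → Anyₚ.map⁺ (Any.map (λ { refl → P-A A′ (λ u v → ≡.sym (A≗A′ u v)) s i }) (∈-allFin ρ))))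

rootedGraphsUpTo : ℕ → List RootedGraph
rootedGraphsUpTo N = concatMap rootedGraphsOfSize (upTo (suc N))

rootedGraphsUpTo-complete : ∀ {P : RootedGraph → Set} {m} N → m ≤ N →
  Any P (rootedGraphsOfSize m) → Any P (rootedGraphsUpTo N)
rootedGraphsUpTo-complete N m≤N found =
  Anyₚ.concatMap⁺ rootedGraphsOfSize (Any.map (λ { refl → found }) (∈-applyUpTo⁺ id (s≤s m≤N)))

module _ {d} (G : Graph) (G-deg : MaxDeg≤ G d) (v : Vertex G) (r : ℕ) where

  private
    inBall = reach G v r
    c = countFin (size G) inBall
    E = enumerate (size G) inBall
    e = proj₁ E
    e-inj = proj₁ (proj₂ E)
    e-sound = proj₁ (proj₂ (proj₂ E))
    e-onto = proj₂ (proj₂ (proj₂ E))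
    A : Fin c → Fin c → Bool
    A i j = adj G (e i) (e j)
    centre = proj₁ (e-onto v (reach-refl G r v))
    e-centre : e centre ≡ v
    e-centre = proj₂ (e-onto v (reach-refl G r v))

    module Copy (A′ : Fin c → Fin c → Bool) (A′≗A : ∀ i j → A′ i j ≡ A i j)
                 (A′-sym : ∀ u v → A′ u v ≡ A′ v u) (A′-irrefl : ∀ v → A′ v v ≡ false) where
      B : Graph
      B = record { size = c ; adj = A′ ; sym = A′-sym ; irrefl = A′-irrefl }

      -- A shortest path from the centre stays inside the ball.
      reach-copy : ∀ k → k ≤ r → ∀ j → reach G v k (e j) ≡ true → reach B centre k j ≡ true
      reach-copy zero    _   j vj =
        subst (λ x → reach B centre 0 x ≡ true) (e-inj (≡.trans e-centre (reach-0⁻ G v (e j) vj))) (reach-0 B centre)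
      reach-copy (suc k) k<r j vj with reach-suc⁻ G v k (e j) vj
      ... | inj₁ vj′ = reach-suc B centre k j (reach-copy k (≤-trans (n≤1+n k) k<r) j vj′)
      ... | inj₂ (w , vw , wj) =
        let i , ei = e-onto w (reach-mono G v w (≤-trans (n≤1+n k) k<r) vw) in
        reach-step B centre k i j
          (reach-copy k (≤-trans (n≤1+n k) k<r) i (subst (λ x → reach G v k x ≡ true) (≡.sym ei) vw))
          (≡.trans (A′≗A i j) (subst (λ x → adj G x (e j) ≡ true) (≡.sym ei) wj))

      copy-hasBallType : HasBallType G v r (rooted B centre)
      copy-hasBallType = e , e-inj , e-centre , e-sound , e-onto , λ w w′ → ≡.sym (A′≗A w w′)

      copy-inTball : InTball r d (rooted B centre)
      copy-inTball = degree-bound , λ j → reach-copy r ≤-refl j (e-sound j)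
        where
        degree-bound : MaxDeg≤ B d
        degree-bound j = ≤-trans (≤-reflexive (countFin-cong c (A′≗A j)))
          (≤-trans (countFin-≤-via (A j) (adj G (e j)) (λ i u → e i ≡ u) (λ i ji → e i , refl , ji)
                                   (λ ei≡u ei′≡u → e-inj (≡.trans ei≡u (≡.sym ei′≡u))))
                   (G-deg (e j)))

  ball-listed : Any (λ σ → HasBallType G v r σ × InTball r d σ) (rootedGraphsUpTo (suc d ^ r))
  ball-listed =
    rootedGraphsUpTo-complete (suc d ^ r) (ball-size G G-deg v r)
      (rootedGraphsOfSize-complete c _ A (λ i j → Graph.sym G (e i) (e j)) (λ i → irrefl G (e i)) centre
        (λ A′ A′≗A s i → Copy.copy-hasBallType A′ A′≗A s i , Copy.copy-inTball A′ A′≗A s i))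

∑-indicator-none : ∀ {A : Set} (p : A → Bool) {xs} → All (λ x → p x ≡ false) xs →
  ∑[ t < length xs ] indicator (p (lookup xs t)) ≡ 0
∑-indicator-none p []           = refl
∑-indicator-none p (px ∷ pxs) rewrite px = ∑-indicator-none p pxs

∑-indicator-unique : ∀ {A : Set} (p : A → Bool) {xs} → AllPairs (λ x y → p x ≡ true → p y ≡ false) xs →
  Any (λ x → p x ≡ true) xs → ∑[ t < length xs ] indicator (p (lookup xs t)) ≡ 1
∑-indicator-unique p {x ∷ xs} (x-excl ∷ excl) found with p x in px
... | true  = cong suc (∑-indicator-none p (All.map (λ excl-y → excl-y refl) x-excl))
... | false with found
...   | here px≡true with () ← ≡.trans (≡.sym px) px≡true
...   | there found′ = ∑-indicator-unique p excl found′

deduplicate-pairwise : ∀ {A : Set} {R : A → A → Set} (R? : ∀ x y → Dec (R x y)) xs →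
  AllPairs (λ x y → ¬ R x y) (deduplicate R? xs)
deduplicate-pairwise R? []       = []
deduplicate-pairwise R? (x ∷ xs) =
  Allₚ.all-filter (¬? ∘ R? x) (deduplicate R? xs) ∷ AllPairsₚ.filter⁺ (¬? ∘ R? x) (deduplicate-pairwise R? xs)

module _ (d r : ℕ) where

  BallType : Set
  BallType = Σ RootedGraph (InTball r d)

  inTball? : ∀ σ → Dec (InTball r d σ)
  inTball? σ = (all? λ v → degree (graph σ) v ≤? d) ×-dec (all? λ u → reach (graph σ) (root σ) r u Bool.≟ true)

  withInTball : List RootedGraph → List BallType
  withInTball []       = []
  withInTball (σ ∷ σs) with inTball? σ
  ... | yes σ-in = (σ , σ-in) ∷ withInTball σs
  ... | no  _    = withInTball σs

  withInTball-complete : ∀ {P : RootedGraph → Set} σs → Any (λ σ → P σ × InTball r d σ) σs →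
    Any (P ∘ proj₁) (withInTball σs)
  withInTball-complete (σ ∷ σs) found with inTball? σ | found
  ... | yes _    | here (pσ , _)   = here pσ
  ... | yes _    | there found′    = there (withInTball-complete σs found′)
  ... | no ¬σ-in | here (_ , σ-in) = ⊥-elim (¬σ-in σ-in)
  ... | no _     | there found′    = withInTball-complete σs found′

  IsTypeOf : BallType → BallType → Set
  IsTypeOf (σ , _) (σ′ , _) = HasBallType (graph σ′) (root σ′) r σ

  ballTypes : List BallType
  ballTypes = deduplicate (λ σ σ′ → hasBallType? (graph (proj₁ σ′)) (root (proj₁ σ′)) r (proj₁ σ))
                          (withInTball (rootedGraphsUpTo (suc d ^ r)))

  ballTypes-complete : ∀ G → MaxDeg≤ G d → ∀ v → Any (λ σ → HasBallType G v r (proj₁ σ)) ballTypes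
  ballTypes-complete G G-deg v =
    Anyₚ.deduplicate⁺ _ (λ {σ′} {σ} σ′-of-type-σ → hasBallType-∘ G v r (proj₁ σ) (proj₁ σ′) (proj₂ (proj₂ σ′)) σ′-of-type-σ)
      (withInTball-complete _ (ball-listed G G-deg v r))

  ballTypes-distinct : AllPairs (λ σ σ′ → ¬ IsTypeOf σ σ′) ballTypes
  ballTypes-distinct = deduplicate-pairwise _ _

  numTypes : ℕ
  numTypes = length ballTypes

  type : Fin numTypes → RootedGraph
  type t = proj₁ (lookup ballTypes t)

  type-in : ∀ t → InTball r d (type t)
  type-in t = proj₂ (lookup ballTypes t)

  unique-type : ∀ G → MaxDeg≤ G d → ∀ y → ∑[ t < numTypes ] indicator (hasBallTypeᵇ G y r (type t)) ≡ 1
  unique-type G G-deg y =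
    ∑-indicator-unique (λ σ → hasBallTypeᵇ G y r (proj₁ σ))
      (AllPairs.map (λ {σ} {σ′} ¬σ′-of-σ yσ → not-both σ σ′ ¬σ′-of-σ yσ) ballTypes-distinct)
      (Any.map (λ {σ} → ⌊⌋-true⁺ (hasBallType? G y r (proj₁ σ))) (ballTypes-complete G G-deg y))
    where
    not-both : ∀ σ σ′ → ¬ IsTypeOf σ σ′ → hasBallTypeᵇ G y r (proj₁ σ) ≡ true → hasBallTypeᵇ G y r (proj₁ σ′) ≡ false
    not-both (σ , _) (σ′ , σ′-in) ¬σ′-of-σ yσ with hasBallType? G y r σ′
    ... | yes yσ′ = ⊥-elim (¬σ′-of-σ (hasBallType-unique G y r σ σ′ (proj₂ σ′-in) (⌊⌋-true⁻ (hasBallType? G y r σ) yσ) yσ′))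
    ... | no  _   = refl


-- Hanf sentences and local forms

≤⇔≤ᵇ : ∀ m n → m ≤ n ⇔ (m ≤ᵇ n) ≡ true
≤⇔≤ᵇ m n = mk⇔ (Equivalence.to T-≡ ∘ ≤⇒≤ᵇ) (≤ᵇ⇒≤ m n ∘ Equivalence.from T-≡)

congMod⇔congModᵇ : ∀ a b ℓ → CongMod a b ℓ ⇔ congModᵇ a b ℓ ≡ true
congMod⇔congModᵇ a b zero    = mk⇔ (Equivalence.to T-≡ ∘ ≡⇒≡ᵇ a b) (≡ᵇ⇒≡ a b ∘ Equivalence.from T-≡)
congMod⇔congModᵇ a b (suc l) = mk⇔ (Equivalence.to T-≡ ∘ ≡⇒≡ᵇ _ _) (≡ᵇ⇒≡ _ _ ∘ Equivalence.from T-≡)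

module _ {d : ℕ} where

  hanfValue : Graph → HanfSentence d → Bool
  hanfValue G (hAtLeast m r τ _)  = m ≤ᵇ typeCount G r τ
  hanfValue G (hMod j ℓ _ r τ _) = congModᵇ (typeCount G r τ) j ℓ

  hnfValue : Graph → HNF d → Bool
  hnfValue G (hanf h)    = hanfValue G h
  hnfValue G (hneg φ)    = not (hnfValue G φ)
  hnfValue G (hconj φ ψ) = hnfValue G φ ∧ hnfValue G ψ
  hnfValue G (hdisj φ ψ) = hnfValue G φ ∨ hnfValue G ψ

  hanfValue⇔ : ∀ G h → ⟦ h ⟧ʰ G ⇔ (hanfValue G h ≡ true)
  hanfValue⇔ G (hAtLeast m r τ _) =
    ≤⇔≤ᵇ m (typeCount G r τ) ⇔-∘ atLeast⇔ G r τ m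
  hanfValue⇔ G (hMod j ℓ _ r τ _) =
    congMod⇔congModᵇ (typeCount G r τ) j ℓ ⇔-∘ countMod⇔ G r τ j ℓ

  hnfValue⇔ : ∀ G φ → ⟦ φ ⟧ᴴ G ⇔ (hnfValue G φ ≡ true)
  hnfValue⇔ G (hanf h)    = hanfValue⇔ G h
  hnfValue⇔ G (hneg φ)    = not≡⇔ (hnfValue G φ) true ⇔-∘ ¬⇔≡false (hnfValue⇔ G φ)
  hnfValue⇔ G (hconj φ ψ) = ∧≡true⇔ _ _ ⇔-∘ (hnfValue⇔ G φ ×-⇔ hnfValue⇔ G ψ)
  hnfValue⇔ G (hdisj φ ψ) = ∨≡true⇔ _ _ ⇔-∘ (hnfValue⇔ G φ ⊎-⇔ hnfValue⇔ G ψ)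

-- Families of Hanf sentences are trees, so that the values of the atoms of a binary
-- combination of local forms are literally a pair.
data Atoms (d : ℕ) : Set where
  none : Atoms d
  atom : HanfSentence d → Atoms d
  _⊗_  : Atoms d → Atoms d → Atoms d

Val : ∀ {d} → Atoms d → Set
Val none      = ⊤
Val (atom _)  = Bool
Val (A ⊗ A′) = Val A × Val A′

eval : ∀ {d} → Graph → (A : Atoms d) → Val A
eval G none      = tt
eval G (atom h)  = hanfValue G h
eval G (A ⊗ A′) = eval G A , eval G A′

⨂ : ∀ {d} k → (Fin k → Atoms d) → Atoms d
⨂ zero    A = none
⨂ (suc k) A = A zero ⊗ ⨂ k (A ∘ suc)

lookupVal : ∀ {d k} (A : Fin k → Atoms d) (i : Fin k) → Val (⨂ k A) → Val (A i)
lookupVal A zero    (v , _)  = v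
lookupVal A (suc i) (_ , vs) = lookupVal (A ∘ suc) i vs

lookupVal-eval : ∀ {d k} (A : Fin k → Atoms d) G (i : Fin k) → lookupVal A i (eval G (⨂ k A)) ≡ eval G (A i)
lookupVal-eval A G zero    = refl
lookupVal-eval A G (suc i) = lookupVal-eval (A ∘ suc) G i

grid : ∀ {d k m} → (Fin k → Fin m → HanfSentence d) → Atoms d
grid {k = k} {m} h = ⨂ k (λ t → ⨂ m (λ c → atom (h t c)))

gridValue : ∀ {d k m} (h : Fin k → Fin m → HanfSentence d) → Val (grid h) → Fin k → Fin m → Bool
gridValue {m = m} h w t c = lookupVal (λ c → atom (h t c)) c (lookupVal (λ t → ⨂ m (λ c → atom (h t c))) t w)

gridValue-eval : ∀ {d k m} (h : Fin k → Fin m → HanfSentence d) G t c → gridValue h (eval G (grid h)) t c ≡ hanfValue G (h t c)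
gridValue-eval {m = m} h G t c =
  ≡.trans (cong (lookupVal (λ c → atom (h t c)) c) (lookupVal-eval (λ t → ⨂ m (λ c → atom (h t c))) G t))
          (lookupVal-eval (λ c → atom (h t c)) G c)

point : RootedGraph
point = rooted (record { size = 1 ; adj = λ _ _ → false ; sym = λ _ _ → refl ; irrefl = λ _ → refl }) zero

point-in : ∀ d → InTball 0 d point
point-in d = (λ _ → z≤n) , λ { zero → refl }

module _ {d : ℕ} where

  -- Hanf normal forms have no constants, but ∃^{≥0} x is always true.
  constᴴ : Bool → HNF d
  constᴴ true  = hanf (hAtLeast 0 0 point (point-in d))
  constᴴ false = hneg (constᴴ true)

  constᴴ-value : ∀ G b → hnfValue G (constᴴ b) ≡ b
  constᴴ-value G true  = refl
  constᴴ-value G false = refl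

  caseᴴ : (A : Atoms d) → (Val A → HNF d) → HNF d
  caseᴴ none      K = K tt
  caseᴴ (atom h)  K = hdisj (hconj (hanf h) (K true)) (hconj (hneg (hanf h)) (K false))
  caseᴴ (A ⊗ A′) K = caseᴴ A (λ v → caseᴴ A′ (λ v′ → K (v , v′)))

  caseᴴ-value : ∀ G A K → hnfValue G (caseᴴ A K) ≡ hnfValue G (K (eval G A))
  caseᴴ-value G none      K = refl
  caseᴴ-value G (atom h)  K with hanfValue G h
  ... | true  = ∨-identityʳ _
  ... | false = refl
  caseᴴ-value G (A ⊗ A′) K =
    ≡.trans (caseᴴ-value G A _) (caseᴴ-value G A′ (λ v′ → K (eval G A , v′)))

record LocalForm (d n : ℕ) : Set₁ where
  field
    atoms  : Atoms d
    radius : ℕ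
    query  : Val atoms → Query n
    local  : ∀ v → Local radius (query v)

open LocalForm

Represents : ∀ {d n} → Formula n → LocalForm d n → Set
Represents {d} φ L = ∀ G → MaxDeg≤ G d → ∀ a → sat G φ a ≡ query L (eval G (atoms L)) G a

module _ {d n : ℕ} where

  atomicForm : (F : Query n) → Local 0 F → LocalForm d n
  atomicForm F F-local = record { atoms = none ; radius = 0 ; query = λ _ → F ; local = λ _ → F-local }

  edgeForm : Fin n → Fin n → LocalForm d n
  edgeForm i j = atomicForm (λ G a → adj G (a i) (a j)) (λ P → adj-rel P (roots P i) (roots P j))

  equalForm : Fin n → Fin n → LocalForm d n
  equalForm i j = atomicForm (λ G a → ⌊ a i ≟ a j ⌋) λ {G} {H} {a} {b} P → true⇔⇒≡
    (λ e → ⌊⌋-true⁺ (b i ≟ b j) (functional P (roots P i)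
             (subst (λ x → rel P x (b j)) (≡.sym (⌊⌋-true⁻ (a i ≟ a j) e)) (roots P j))))
    (λ e → ⌊⌋-true⁺ (a i ≟ a j) (injective P (roots P i)
             (subst (rel P (a j)) (≡.sym (⌊⌋-true⁻ (b i ≟ b j) e)) (roots P j))))

  notForm : LocalForm d n → LocalForm d n
  notForm L = record L { query = λ v G a → not (query L v G a) ; local = λ v P → cong not (local L v P) }

  binaryForm : (Bool → Bool → Bool) → LocalForm d n → LocalForm d n → LocalForm d n
  binaryForm _∙_ L L′ = record
    { atoms  = atoms L ⊗ atoms L′
    ; radius = radius L ⊔ radius L′
    ; query  = λ (v , v′) G a → query L v G a ∙ query L′ v′ G a
    ; local  = λ (v , v′) P → cong₂ _∙_ (local-mono (m≤m⊔n _ _) (local L v) P) (local-mono (m≤n⊔m _ _) (local L′ v′) P)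
    }

-- Eliminating quantifiers

anyFin-false : ∀ n → anyFin n (λ _ → false) ≡ false
anyFin-false zero    = refl
anyFin-false (suc n) = anyFin-false n

suc≤ᵇ+ : ∀ x y → (suc x ≤ᵇ x + y) ≡ (1 ≤ᵇ y)
suc≤ᵇ+ zero    y = refl
suc≤ᵇ+ (suc x) y = suc≤ᵇ+ x y

anyFin-select : ∀ C x (g : ℕ → Bool) → x ≤ C → anyFin (suc C) (λ c → (x ≡ᵇ toℕ c) ∧ g (toℕ c)) ≡ g x
anyFin-select C       zero    g _         = ≡.trans (cong (g 0 ∨_) (anyFin-false C)) (∨-identityʳ (g 0))
anyFin-select (suc C) (suc x) g (s≤s x≤C) = anyFin-select C x (g ∘ suc) x≤C

∑-zero : ∀ n {f : Fin n → ℕ} → (∀ i → f i ≡ 0) → ∑[ i < n ] f i ≡ 0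
∑-zero zero    f≡0 = refl
∑-zero (suc n) f≡0 = cong₂ _+_ (f≡0 zero) (∑-zero n (f≡0 ∘ suc))

∑-indicator-select : ∀ n (p : Fin n → Bool) (f : Fin n → ℕ) c₀ → p c₀ ≡ true → (∀ c → p c ≡ true → c ≡ c₀) →
  ∑[ c < n ] (indicator (p c) * f c) ≡ f c₀
∑-indicator-select (suc n) p f zero p0 only-c₀ rewrite p0 =
  ≡.trans (cong₂ _+_ (+-identityʳ (f zero)) (∑-zero n rest-zero)) (+-identityʳ (f zero))
  where
  rest-zero : ∀ c → indicator (p (suc c)) * f (suc c) ≡ 0
  rest-zero c with p (suc c) in pc
  ... | false = refl
  ... | true  with () ← only-c₀ (suc c) pc
∑-indicator-select (suc n) p f (suc c₀) pc₀ only-c₀ with p zero in p0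
... | true  with () ← only-c₀ zero p0
... | false = ∑-indicator-select n (p ∘ suc) (f ∘ suc) c₀ pc₀ (λ c pc → suc-injective (only-c₀ (suc c) pc))

module Modular (l : ℕ) where

  ℓ : ℕ
  ℓ = suc l

  infix 4 _≈_
  _≈_ : ℕ → ℕ → Set
  x ≈ y = x % ℓ ≡ y % ℓ

  ≈-+ : ∀ x x′ y y′ → x ≈ x′ → y ≈ y′ → x + y ≈ x′ + y′
  ≈-+ x x′ y y′ x≈x′ y≈y′ =
    ≡.trans (%-distribˡ-+ x y ℓ) (≡.trans (cong₂ (λ u v → (u + v) % ℓ) x≈x′ y≈y′) (≡.sym (%-distribˡ-+ x′ y′ ℓ)))

  ≈-cancelʳ : ∀ x y z → x + z ≈ y + z → x ≈ y
  ≈-cancelʳ x y z x+z≈y+z = ≡.trans (≡.sym (add-multiple x)) (≡.trans (≈-+ (x + z) (y + z) (z * l) (z * l) x+z≈y+z refl) (add-multiple y))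
    where
    add-multiple : ∀ u → (u + z + z * l) % ℓ ≡ u % ℓ
    add-multiple u = ≡.trans (cong (_% ℓ) (≡.trans (+-assoc u z (z * l)) (cong (u +_) (≡.sym (*-suc z l)))))
                             ([m+kn]%n≡m%n u z ℓ)

  congModᵇ-cancelʳ : ∀ x y z → congModᵇ (x + z) (y + z) ℓ ≡ congModᵇ x y ℓ
  congModᵇ-cancelʳ x y z = true⇔⇒≡
    (Equivalence.to (congMod⇔congModᵇ x y ℓ) ∘ ≈-cancelʳ x y z ∘ Equivalence.from (congMod⇔congModᵇ (x + z) (y + z) ℓ))
    (Equivalence.to (congMod⇔congModᵇ (x + z) (y + z) ℓ) ∘ (λ x≈y → ≈-+ x y z z x≈y refl) ∘ Equivalence.from (congMod⇔congModᵇ x y ℓ))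

  congModᵇ-congˡ : ∀ x x′ y → x ≈ x′ → congModᵇ x y ℓ ≡ congModᵇ x′ y ℓ
  congModᵇ-congˡ x x′ y x≈x′ = cong (_≡ᵇ y % ℓ) x≈x′

  ≈-∑ : ∀ T (f g : Fin T → ℕ) → (∀ t → f t ≈ g t) → ∑[ t < T ] f t ≈ ∑[ t < T ] g t
  ≈-∑ zero    f g f≈g = refl
  ≈-∑ (suc T) f g f≈g = ≈-+ (f zero) (g zero) (∑[ t < T ] f (suc t)) (∑[ t < T ] g (suc t)) (f≈g zero) (≈-∑ T (f ∘ suc) (g ∘ suc) (f≈g ∘ suc))

  ≈-indicator* : ∀ b x y → x ≈ y → indicator b * x ≈ indicator b * y
  ≈-indicator* false x y x≈y = refl
  ≈-indicator* true  x y x≈y = ≈-+ x y 0 0 x≈y refl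

  residue : (Fin ℓ → Bool) → ℕ
  residue V = ∑[ c < ℓ ] (indicator (V c) * toℕ c)

  residue-correct : ∀ x → residue (λ c → congModᵇ x (toℕ c) ℓ) ≡ x % ℓ
  residue-correct x =
    ≡.trans (∑-indicator-select ℓ (λ c → congModᵇ x (toℕ c) ℓ) toℕ c₀ c₀-matches only-c₀) (toℕ-fromℕ< x%ℓ<ℓ)
    where
    x%ℓ<ℓ = m%n<n x ℓ
    c₀ = fromℕ< x%ℓ<ℓ
    c₀-matches : congModᵇ x (toℕ c₀) ℓ ≡ true
    c₀-matches = Equivalence.to (congMod⇔congModᵇ x (toℕ c₀) ℓ)
      (≡.sym (≡.trans (cong (_% ℓ) (toℕ-fromℕ< x%ℓ<ℓ)) (m%n%n≡m%n x ℓ)))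
    only-c₀ : ∀ c → congModᵇ x (toℕ c) ℓ ≡ true → c ≡ c₀
    only-c₀ c matches = toℕ-injective (≡.trans (≡.sym (m<n⇒m%n≡m (toℕ<n c)))
      (≡.trans (≡.sym (Equivalence.from (congMod⇔congModᵇ x (toℕ c) ℓ) matches)) (≡.sym (toℕ-fromℕ< x%ℓ<ℓ))))

  %-≈ : ∀ x → x % ℓ ≈ x
  %-≈ x = m%n%n≡m%n x ℓ


module Quantifier (d : ℕ) {n : ℕ} (r : ℕ) where

  T : ℕ
  T = numTypes d r

  σ : Fin T → RootedGraph
  σ = type d r

  σ-within : ∀ t → WithinRadius r (σ t)
  σ-within t = proj₂ (type-in d r t)

  near : (G : Graph) → (Fin n → Vertex G) → Vertex G → Bool
  near G a y = anyFin n (λ i → reach G (a i) (near-radius r) y)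

  nearCount farCount : Query (suc n) → (G : Graph) → (Fin n → Vertex G) → ℕ
  nearCount g G a = countFin (size G) (λ y → g G (extend a y) ∧ near G a y)
  farCount  g G a = countFin (size G) (λ y → g G (extend a y) ∧ not (near G a y))

  hasType : Fin T → Query (suc n)
  hasType t G a = hasBallTypeᵇ G (a zero) r (σ t)

  -- Near vertices lie in a union of n balls, so there are at most C of them.
  C : ℕ
  C = n * suc d ^ near-radius r

  nearCount-local : ∀ g → Local r g → Local (step-radius r) (nearCount g)
  nearCount-local g g-local P =
    countFin-≡-via _ _ (rel P) (transfer P) (transfer (iso-sym P)) (functional P) (injective P)
    where
    transfer : ∀ {G H a b} (Q : NbhdIso G H a b (step-radius r)) y → (g G (extend a y) ∧ near G a y) ≡ true →
      ∃ λ w → rel Q y w × (g H (extend b w) ∧ near H b w) ≡ true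
    transfer {G} {H} {a} {b} Q y gy∧near =
      let gy , y-near = ∧-true⁻ gy∧near
          i , ay = anyFin⁻ n _ y-near
          w , yw = total Q y (i , reach-mono G (a i) y (m≤n+m (near-radius r) r) ay)
          j , bw = near-transport r Q yw (i , ay)
      in w , yw , ∧-true⁺ (≡.trans (≡.sym (g-local (iso-extend-near r Q yw (i , ay)))) gy)
                          (anyFin⁺ n _ j bw)

  hasType-local : ∀ t → Local r (hasType t)
  hasType-local t P = hasBallTypeᵇ-local P zero (σ t)

  typeCount-split : ∀ G a t → typeCount G r (σ t) ≡ nearCount (hasType t) G a + farCount (hasType t) G a
  typeCount-split G a t = countFin-split (size G) _ (near G a)

  module _ (G : Graph) (G-deg : MaxDeg≤ G d) (a : Fin n → Vertex G) where

    nearCount≤C : ∀ t → nearCount (hasType t) G a ≤ C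
    nearCount≤C t = ≤-trans (countFin-mono (size G) (λ y → proj₂ ∘ ∧-true⁻))
                            (nbhd-size G G-deg a (near-radius r))

    far-exists : ∀ t → (1 ≤ᵇ farCount (hasType t) G a)
      ≡ anyFin (suc C) (λ c → (nearCount (hasType t) G a ≡ᵇ toℕ c) ∧ (suc (toℕ c) ≤ᵇ typeCount G r (σ t)))
    far-exists t = begin
      1 ≤ᵇ farCount (hasType t) G a
        ≡⟨ suc≤ᵇ+ (nearCount (hasType t) G a) _ ⟨
      suc (nearCount (hasType t) G a) ≤ᵇ nearCount (hasType t) G a + farCount (hasType t) G a
        ≡⟨ cong (suc (nearCount (hasType t) G a) ≤ᵇ_) (typeCount-split G a t) ⟨
      suc (nearCount (hasType t) G a) ≤ᵇ typeCount G r (σ t)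
        ≡⟨ anyFin-select C _ (λ x → suc x ≤ᵇ typeCount G r (σ t)) (nearCount≤C t) ⟨
      anyFin (suc C) (λ c → (nearCount (hasType t) G a ≡ᵇ toℕ c) ∧ (suc (toℕ c) ≤ᵇ typeCount G r (σ t)))
        ∎
      where open ≡-Reasoning

  module _ (f : Query (suc n)) (f-local : Local r f) where

    -- The value f takes at any far vertex of type t: the query evaluated at the
    -- root of a fresh copy of that ball.
    farValue : Fin T → Query n
    farValue t G a = f (G ⊕ graph (σ t)) (attach G a (σ t))

    farValue-local : ∀ t → Local r (farValue t)
    farValue-local t P = f-local (iso-⊕ (σ t) (σ-within t) P)

    module _ (G : Graph) (G-deg : MaxDeg≤ G d) (a : Fin n → Vertex G) where

      far-value : ∀ t y → near G a y ≡ false → hasBallTypeᵇ G y r (σ t) ≡ true → f G (extend a y) ≡ farValue t G a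
      far-value t y y-far y-type = f-local (iso-extend-far G a (σ t) r far (σ-within t) (⌊⌋-true⁻ (hasBallType? G y r (σ t)) y-type))
        where
        far : ¬ InNbhd G a (near-radius r) y
        far (i , ay) with () ← ≡.trans (≡.sym (anyFin⁺ n _ i ay)) y-far

      far-decomposition : farCount f G a ≡ ∑[ t < T ] (indicator (farValue t G a) * farCount (hasType t) G a)
      far-decomposition = ≡.trans
        (countFin-partition (size G) T _ (λ t y → hasBallTypeᵇ G y r (σ t)) (unique-type d r G G-deg))
        (sum-cong-≗ {T} λ t → ≡.trans (countFin-cong (size G) (at-type t)) (countFin-∧ˡ (size G) (farValue t G a) _))
        where
        at-type : ∀ t y → (f G (extend a y) ∧ not (near G a y)) ∧ hasBallTypeᵇ G y r (σ t)
                         ≡ farValue t G a ∧ (hasBallTypeᵇ G y r (σ t) ∧ not (near G a y))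
        at-type t y with near G a y in y-near | hasBallTypeᵇ G y r (σ t) in y-type
        ... | true  | h     = ≡.trans (cong (_∧ h) (∧-zeroʳ _)) (≡.sym (≡.trans (cong (farValue t G a ∧_) (∧-zeroʳ h)) (∧-zeroʳ _)))
        ... | false | false = ≡.trans (∧-zeroʳ _) (≡.sym (∧-zeroʳ _))
        ... | false | true  =
          ≡.trans (∧-identityʳ _) (≡.trans (∧-identityʳ _) (≡.trans (far-value t y y-near y-type) (≡.sym (∧-identityʳ _))))

      count-split : countFin (size G) (λ y → f G (extend a y)) ≡ nearCount f G a + farCount f G a
      count-split = countFin-split (size G) _ (near G a)

    -- V t c stands for ∃^{≥ c+1} x (r , σ t); a far witness of type t exists iff
    -- this holds for c the number of near vertices of type t.
    exQuery : (Fin T → Fin (suc C) → Bool) → Query n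
    exQuery V G a = (1 ≤ᵇ nearCount f G a) ∨
      anyFin T (λ t → farValue t G a ∧ anyFin (suc C) (λ c → (nearCount (hasType t) G a ≡ᵇ toℕ c) ∧ V t c))

    exQuery-local : ∀ V → Local (step-radius r) (exQuery V)
    exQuery-local V P = cong₂ _∨_ (cong (1 ≤ᵇ_) (nearCount-local f f-local P)) (anyFin-cong T λ t →
      cong₂ _∧_ (farValue-local t (iso-restrict (m≤m+n r (near-radius r)) P)) (anyFin-cong (suc C) λ c →
        cong (λ k → (k ≡ᵇ toℕ c) ∧ V t c) (nearCount-local (hasType t) (hasType-local t) P)))

    exQuery-cong : ∀ {V V′} → (∀ t c → V t c ≡ V′ t c) → ∀ G a → exQuery V G a ≡ exQuery V′ G a
    exQuery-cong V≡V′ G a = cong ((1 ≤ᵇ nearCount f G a) ∨_) (anyFin-cong T λ t →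
      cong (farValue t G a ∧_) (anyFin-cong (suc C) λ c → cong ((nearCount (hasType t) G a ≡ᵇ toℕ c) ∧_) (V≡V′ t c)))

    ex-value : ∀ G → MaxDeg≤ G d → ∀ a →
      anyFin (size G) (λ y → f G (extend a y)) ≡ exQuery (λ t c → suc (toℕ c) ≤ᵇ typeCount G r (σ t)) G a
    ex-value G G-deg a = begin
      anyFin (size G) (λ y → f G (extend a y))
        ≡⟨ anyFin≡1≤ᵇcountFin (size G) _ ⟩
      1 ≤ᵇ countFin (size G) (λ y → f G (extend a y))
        ≡⟨ cong (1 ≤ᵇ_) (≡.trans (count-split G G-deg a) (cong (nearCount f G a +_) (far-decomposition G G-deg a))) ⟩
      1 ≤ᵇ (nearCount f G a + ∑[ t < T ] (indicator (farValue t G a) * farCount (hasType t) G a))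
        ≡⟨ 1≤ᵇ+ (nearCount f G a) _ ⟩
      (1 ≤ᵇ nearCount f G a) ∨ (1 ≤ᵇ ∑[ t < T ] (indicator (farValue t G a) * farCount (hasType t) G a))
        ≡⟨ cong ((1 ≤ᵇ nearCount f G a) ∨_) (≡.trans (1≤ᵇ∑ T _) (anyFin-cong T λ t →
             ≡.trans (1≤ᵇindicator* (farValue t G a) _) (cong (farValue t G a ∧_) (far-exists G G-deg a t)))) ⟩
      exQuery (λ t c → suc (toℕ c) ≤ᵇ typeCount G r (σ t)) G a
        ∎
      where open ≡-Reasoning

    module _ (j l : ℕ) where

      open Modular l

      weightedNear : (G : Graph) → (Fin n → Vertex G) → ℕ
      weightedNear G a = ∑[ t < T ] (indicator (farValue t G a) * nearCount (hasType t) G a)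

      -- V t c stands for ∃^{c (mod ℓ)} x (r , σ t).
      modQuery : (Fin T → Fin ℓ → Bool) → Query n
      modQuery V G a = congModᵇ (nearCount f G a + ∑[ t < T ] (indicator (farValue t G a) * residue (V t)))
                                (j + weightedNear G a) ℓ

      modQuery-local : ∀ V → Local (step-radius r) (modQuery V)
      modQuery-local V P = cong₂ (λ x y → congModᵇ x y ℓ)
        (cong₂ _+_ (nearCount-local f f-local P) (sum-cong-≗ {T} λ t → cong (λ b → indicator b * residue (V t)) (farValue-local′ t)))
        (cong (j +_) (sum-cong-≗ {T} λ t → cong₂ (λ b k → indicator b * k) (farValue-local′ t) (nearCount-local (hasType t) (hasType-local t) P)))
        where farValue-local′ = λ t → farValue-local t (iso-restrict (m≤m+n r (near-radius r)) P)

      modQuery-cong : ∀ {V V′} → (∀ t c → V t c ≡ V′ t c) → ∀ G a → modQuery V G a ≡ modQuery V′ G a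
      modQuery-cong V≡V′ G a = cong (λ x → congModᵇ (nearCount f G a + x) (j + weightedNear G a) ℓ)
        (sum-cong-≗ {T} λ t → cong (indicator (farValue t G a) *_) (sum-cong-≗ {ℓ} λ c → cong (λ b → indicator b * toℕ c) (V≡V′ t c)))

      -- Adding the near vertices of the far-realised types to both sides turns far counts
      -- into type counts without subtracting.
      count+weightedNear : ∀ G → MaxDeg≤ G d → ∀ a →
        countFin (size G) (λ y → f G (extend a y)) + weightedNear G a
          ≡ nearCount f G a + ∑[ t < T ] (indicator (farValue t G a) * typeCount G r (σ t))
      count+weightedNear G G-deg a = begin
        countFin (size G) (λ y → f G (extend a y)) + weightedNear G a
          ≡⟨ cong (_+ weightedNear G a) (≡.trans (count-split G G-deg a) (cong (nearCount f G a +_) (far-decomposition G G-deg a))) ⟩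
        nearCount f G a + ∑[ t < T ] (Φ t * farCount (hasType t) G a) + weightedNear G a
          ≡⟨ +-assoc (nearCount f G a) _ _ ⟩
        nearCount f G a + (∑[ t < T ] (Φ t * farCount (hasType t) G a) + weightedNear G a)
          ≡⟨ cong (nearCount f G a +_) (∑-distrib-+ {T} _ _) ⟨
        nearCount f G a + ∑[ t < T ] (Φ t * farCount (hasType t) G a + Φ t * nearCount (hasType t) G a)
          ≡⟨ cong (nearCount f G a +_) (sum-cong-≗ {T} λ t → ≡.trans (≡.sym (*-distribˡ-+ (Φ t) (farCount (hasType t) G a) (nearCount (hasType t) G a)))
               (cong (Φ t *_) (≡.trans (+-comm (farCount (hasType t) G a) _) (≡.sym (typeCount-split G a t))))) ⟩
        nearCount f G a + ∑[ t < T ] (Φ t * typeCount G r (σ t))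
          ∎
        where
        open ≡-Reasoning
        Φ = λ t → indicator (farValue t G a)

      mod-value : ∀ G → MaxDeg≤ G d → ∀ a →
        congModᵇ (countFin (size G) (λ y → f G (extend a y))) j ℓ
          ≡ modQuery (λ t c → congModᵇ (typeCount G r (σ t)) (toℕ c) ℓ) G a
      mod-value G G-deg a = begin
        congModᵇ X j ℓ
          ≡⟨ congModᵇ-cancelʳ X j (weightedNear G a) ⟨
        congModᵇ (X + weightedNear G a) (j + weightedNear G a) ℓ
          ≡⟨ cong (λ x → congModᵇ x (j + weightedNear G a) ℓ) (count+weightedNear G G-deg a) ⟩
        congModᵇ (nearCount f G a + ∑[ t < T ] (Φ t * typeCount G r (σ t))) (j + weightedNear G a) ℓ
          ≡⟨ congModᵇ-congˡ counted read (j + weightedNear G a) counted≈read ⟩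
        modQuery (λ t c → congModᵇ (typeCount G r (σ t)) (toℕ c) ℓ) G a
          ∎
        where
        open ≡-Reasoning
        X = countFin (size G) (λ y → f G (extend a y))
        Φ = λ t → indicator (farValue t G a)
        V = λ t c → congModᵇ (typeCount G r (σ t)) (toℕ c) ℓ
        counted read : ℕ
        counted = nearCount f G a + ∑[ t < T ] (Φ t * typeCount G r (σ t))
        read    = nearCount f G a + ∑[ t < T ] (Φ t * residue (V t))
        counted≈read : counted ≈ read
        counted≈read = ≈-+ (nearCount f G a) (nearCount f G a) _ _ refl
          (≈-∑ T (λ t → Φ t * typeCount G r (σ t)) (λ t → Φ t * residue (V t)) λ t →
            ≈-indicator* (farValue t G a) (typeCount G r (σ t)) (residue (V t))
              (≡.sym (≡.trans (cong (_% ℓ) (residue-correct (typeCount G r (σ t)))) (%-≈ (typeCount G r (σ t))))))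


-- Hanf normal form

module _ {d : ℕ} where

  exAtom : ∀ {n} r → Fin (numTypes d r) → Fin (suc (Quantifier.C d {n} r)) → HanfSentence d
  exAtom r t c = hAtLeast (suc (toℕ c)) r (type d r t) (type-in d r t)

  modAtom : ∀ r l → Fin (numTypes d r) → Fin (suc l) → HanfSentence d
  modAtom r l t c = hMod (toℕ c) (suc l) (s≤s z≤n) r (type d r t) (type-in d r t)

  exForm : ∀ {n} → LocalForm d (suc n) → LocalForm d n
  exForm {n} L = record
    { atoms  = atoms L ⊗ grid (exAtom {n} (radius L))
    ; radius = step-radius (radius L)
    ; query  = λ (v , w) → exQuery (query L v) (local L v) (gridValue (exAtom {n} (radius L)) w)
    ; local  = λ (v , w) → exQuery-local (query L v) (local L v) (gridValue (exAtom {n} (radius L)) w)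
    }
    where open Quantifier d {n} (radius L)

  exForm-represents : ∀ {n} (φ : Formula (suc n)) L → Represents φ L → Represents (ex φ) (exForm L)
  exForm-represents {n} φ L L-represents G G-deg a = begin
    anyFin (size G) (λ y → sat G φ (extend a y))
      ≡⟨ anyFin-cong (size G) (λ y → L-represents G G-deg (extend a y)) ⟩
    anyFin (size G) (λ y → query L v G (extend a y))
      ≡⟨ ex-value (query L v) (local L v) G G-deg a ⟩
    exQuery (query L v) (local L v) (λ t c → hanfValue G (exAtom {n} (radius L) t c)) G a
      ≡⟨ exQuery-cong (query L v) (local L v) (λ t c → gridValue-eval (exAtom {n} (radius L)) G t c) G a ⟨
    query (exForm L) (eval G (atoms (exForm L))) G a
      ∎
    where
    open Quantifier d {n} (radius L)
    open ≡-Reasoning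
    v = eval G (atoms L)

  modForm : ∀ {n} (j l : ℕ) → LocalForm d (suc n) → LocalForm d n
  modForm {n} j l L = record
    { atoms  = atoms L ⊗ grid (modAtom (radius L) l)
    ; radius = step-radius (radius L)
    ; query  = λ (v , w) → modQuery (query L v) (local L v) j l (gridValue (modAtom (radius L) l) w)
    ; local  = λ (v , w) → modQuery-local (query L v) (local L v) j l (gridValue (modAtom (radius L) l) w)
    }
    where open Quantifier d {n} (radius L)

  modForm-represents : ∀ {n} j l p (φ : Formula (suc n)) L → Represents φ L → Represents (exMod j (suc l) p φ) (modForm j l L)
  modForm-represents {n} j l p φ L L-represents G G-deg a = begin
    congModᵇ (countFin (size G) (λ y → sat G φ (extend a y))) j (suc l)
      ≡⟨ cong (λ k → congModᵇ k j (suc l)) (countFin-cong (size G) (λ y → L-represents G G-deg (extend a y))) ⟩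
    congModᵇ (countFin (size G) (λ y → query L v G (extend a y))) j (suc l)
      ≡⟨ mod-value (query L v) (local L v) j l G G-deg a ⟩
    modQuery (query L v) (local L v) j l (λ t c → hanfValue G (modAtom (radius L) l t c)) G a
      ≡⟨ modQuery-cong (query L v) (local L v) j l (λ t c → gridValue-eval (modAtom (radius L) l) G t c) G a ⟨
    query (modForm j l L) (eval G (atoms (modForm j l L))) G a
      ∎
    where
    open Quantifier d {n} (radius L)
    open ≡-Reasoning
    v = eval G (atoms L)

  localForm : ∀ {n} → Formula n → LocalForm d n
  localForm (edge i j)             = edgeForm i j
  localForm (equal i j)            = equalForm i j
  localForm (neg φ)                = notForm (localForm φ)
  localForm (conj φ ψ)             = binaryForm _∧_ (localForm φ) (localForm ψ)
  localForm (disj φ ψ)             = binaryForm _∨_ (localForm φ) (localForm ψ)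
  localForm (ex φ)                 = exForm (localForm φ)
  localForm (all φ)                = notForm (exForm (notForm (localForm φ)))
  localForm (exMod j (suc l) _ φ)  = modForm j l (localForm φ)

  localForm-represents : ∀ {n} (φ : Formula n) → Represents φ (localForm φ)
  localForm-represents (edge i j)  G G-deg a = refl
  localForm-represents (equal i j) G G-deg a = refl
  localForm-represents (neg φ)     G G-deg a = cong not (localForm-represents φ G G-deg a)
  localForm-represents (conj φ ψ)  G G-deg a =
    ≡.cong₂ _∧_ (localForm-represents φ G G-deg a) (localForm-represents ψ G G-deg a)
  localForm-represents (disj φ ψ)  G G-deg a =
    ≡.cong₂ _∨_ (localForm-represents φ G G-deg a) (localForm-represents ψ G G-deg a)
  localForm-represents (ex φ) = exForm-represents φ (localForm φ) (localForm-represents φ)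
  localForm-represents (all φ) G G-deg a =
    cong not (exForm-represents (neg φ) (notForm (localForm φ))
               (λ G G-deg a → cong not (localForm-represents φ G G-deg a)) G G-deg a)
  localForm-represents (exMod j (suc l) p φ) = modForm-represents j l p φ (localForm φ) (localForm-represents φ)

  hanf-normal-form : (φ : Sentence) → Σ (HNF d) λ χ → (λ G → G ⊨ φ) ≡[ d ] ⟦ χ ⟧ᴴ
  hanf-normal-form φ = χ , λ G G-deg →
      (λ G⊨φ → Equivalence.from (hnfValue⇔ G χ) (≡.trans (≡.sym (value G G-deg _)) G⊨φ))
    , (λ χ-holds → ≡.trans (value G G-deg _) (Equivalence.to (hnfValue⇔ G χ) χ-holds))
    where
    L = localForm φ
    -- A local query without free variables is constant, so it may be evaluated on any graph.
    χ : HNF d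
    χ = caseᴴ (atoms L) (λ v → constᴴ (query L v (graph point) (λ ())))
    value : ∀ G → MaxDeg≤ G d → ∀ a → sat G φ a ≡ hnfValue G χ
    value G G-deg a = begin
      sat G φ a
        ≡⟨ localForm-represents φ G G-deg a ⟩
      query L (eval G (atoms L)) G a
        ≡⟨ local L (eval G (atoms L)) iso-empty ⟩
      query L (eval G (atoms L)) (graph point) (λ ())
        ≡⟨ constᴴ-value G _ ⟨
      hnfValue G (constᴴ (query L (eval G (atoms L)) (graph point) (λ ())))
        ≡⟨ caseᴴ-value G (atoms L) _ ⟨
      hnfValue G χ
        ∎
      where open ≡-Reasoning

-- Disjunctive normal form

module _ {d K : ℕ} where

  _∧ᴰ_ : DNF d K → DNF d K → DNF d K
  _∧ᴰ_ = cartesianProductWith _++_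

  ++⇔ : ∀ (ψ ψ′ : DNF d K) G → ⟦ ψ ++ ψ′ ⟧ᴰ G ⇔ (⟦ ψ ⟧ᴰ G ⊎ ⟦ ψ′ ⟧ᴰ G)
  ++⇔ ψ ψ′ G = mk⇔ (Anyₚ.++⁻ ψ) [ Anyₚ.++⁺ˡ , Anyₚ.++⁺ʳ ψ ]′

  ∧ᴰ⇔ : ∀ (ψ ψ′ : DNF d K) G → ⟦ ψ ∧ᴰ ψ′ ⟧ᴰ G ⇔ (⟦ ψ ⟧ᴰ G × ⟦ ψ′ ⟧ᴰ G)
  ∧ᴰ⇔ ψ ψ′ G = mk⇔
    (Anyₚ.cartesianProductWith⁻ _++_ (Allₚ.++⁻ _) ψ ψ′)
    (λ (x , y) → Anyₚ.cartesianProductWith⁺ _++_ Allₚ.++⁺ x y)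

  someAtom : ∀ {X} {P : Fin X → Set} → Decidable P → (Fin X → Atom d K) → DNF d K
  someAtom {X} P? f = map (λ i → [ f i ]) (filter P? (allFin X))

  someAtom⇔ : ∀ {X} {P : Fin X → Set} (P? : Decidable P) f G → ⟦ someAtom P? f ⟧ᴰ G ⇔ (∃ λ i → P i × ⟦ f i ⟧ᵃ G)
  someAtom⇔ {X} P? f G = mk⇔
    (λ s → let i , i∈ , fi = find (Anyₚ.map⁻ s) in i , proj₂ (∈-filter⁻ P? {xs = allFin X} i∈) , Allₚ.singleton⁻ fi)
    (λ (i , pi , fi) → Anyₚ.map⁺ (lose (∈-filter⁺ P? (∈-allFin i) pi) (fi ∷ [])))

  singleton⇔ : ∀ (a : Atom d K) G → ⟦ [ [ a ] ] ⟧ᴰ G ⇔ ⟦ a ⟧ᵃ G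
  singleton⇔ a G = mk⇔ (λ { (here (p ∷ [])) → p }) (λ p → here (p ∷ []))

  ∧ᴰ-all : ∀ {P : Atom d K → Set} {ψ ψ′} → All (All P) ψ → All (All P) ψ′ → All (All P) (ψ ∧ᴰ ψ′)
  ∧ᴰ-all []         _   = []
  ∧ᴰ-all (c ∷ cs) cs′ = Allₚ.++⁺ (Allₚ.map⁺ (All.map (Allₚ.++⁺ c) cs′)) (∧ᴰ-all cs cs′)

  module _ (r : ℕ) (τ : RootedGraph) (τ-in : InTball r d τ) where

    exactlyAt : Fin K → Atom d K
    exactlyAt i = exactlyM (toℕ i) (toℕ<n i) r τ τ-in

    atLeastDNF belowDNF : ℕ → DNF d K
    atLeastDNF m = [ [ atLeastK r τ τ-in ] ] ++ someAtom (λ i → m ≤? toℕ i) exactlyAt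
    belowDNF   m = someAtom (λ i → toℕ i <? m) exactlyAt

    residueAtom : ∀ l → Fin (suc l) → Atom d K
    residueAtom l c = modJ (toℕ c) (suc l) (toℕ<n c) r τ τ-in

    congDNF incongDNF : ℕ → ℕ → DNF d K
    congDNF   l j = [ [ modJ (j % suc l) (suc l) (m%n<n j (suc l)) r τ τ-in ] ]
    incongDNF l j = someAtom (λ c → ¬? (toℕ c ℕ.≟ j % suc l)) (residueAtom l)

    Uniform : Atom d K → Set
    Uniform a = atomRadius a ≡ r × RootedIso (atomType a) τ

    private
      uniform : ∀ {r′} {τ′ : RootedGraph} → r′ ≡ r → τ′ ≡ τ → r′ ≡ r × RootedIso τ′ τ
      uniform refl refl = refl , (λ x → x) , (λ x → x) , (λ _ → refl) , (λ _ → refl) , refl , (λ _ _ → refl)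

      someAtom-uniform : ∀ {X} {P : Fin X → Set} (P? : Decidable P) f →
        (∀ i → atomRadius (f i) ≡ r) → (∀ i → atomType (f i) ≡ τ) → All (All Uniform) (someAtom P? f)
      someAtom-uniform P? f f-r f-τ = Allₚ.map⁺ (All.universal (λ i → uniform (f-r i) (f-τ i) ∷ []) _)

    atLeastDNF-uniform : ∀ m → All (All Uniform) (atLeastDNF m)
    atLeastDNF-uniform m = Allₚ.++⁺ ((uniform refl refl ∷ []) ∷ []) (someAtom-uniform (λ i → m ≤? toℕ i) exactlyAt (λ _ → refl) (λ _ → refl))

    belowDNF-uniform : ∀ m → All (All Uniform) (belowDNF m)
    belowDNF-uniform m = someAtom-uniform (λ i → toℕ i <? m) exactlyAt (λ _ → refl) (λ _ → refl)

    congDNF-uniform : ∀ l j → All (All Uniform) (congDNF l j)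
    congDNF-uniform l j = (uniform refl refl ∷ []) ∷ []

    incongDNF-uniform : ∀ l j → All (All Uniform) (incongDNF l j)
    incongDNF-uniform l j = someAtom-uniform (λ c → ¬? (toℕ c ℕ.≟ j % suc l)) (residueAtom l) (λ _ → refl) (λ _ → refl)

    module _ (G : Graph) where

      private
        N = typeCount G r τ

        exactlyAt⇔ : ∀ i → ⟦ exactlyAt i ⟧ᵃ G ⇔ (N ≡ toℕ i)
        exactlyAt⇔ i = exactly⇔ G r τ (toℕ i)

        count-at : N < K → ∃ λ i → toℕ i ≡ N
        count-at N<K = fromℕ< N<K , toℕ-fromℕ< N<K

      atLeastDNF⇔ : ∀ {m} → m ≤ K → ⟦ atLeastDNF m ⟧ᴰ G ⇔ (m ≤ N)
      atLeastDNF⇔ {m} m≤K = mk⇔ to from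
        where
        to : ⟦ atLeastDNF m ⟧ᴰ G → m ≤ N
        to s with Equivalence.to (++⇔ _ _ G) s
        ... | inj₁ K-many = ≤-trans m≤K (Equivalence.to (atLeast⇔ G r τ K) (Equivalence.to (singleton⇔ (atLeastK r τ τ-in) G) K-many))
        ... | inj₂ exact  = let i , m≤i , N≡i = Equivalence.to (someAtom⇔ (λ i → m ≤? toℕ i) exactlyAt G) exact in
                            subst (m ≤_) (≡.sym (Equivalence.to (exactlyAt⇔ i) N≡i)) m≤i
        from : m ≤ N → ⟦ atLeastDNF m ⟧ᴰ G
        from m≤N with K ≤? N
        ... | yes K≤N = Equivalence.from (++⇔ _ _ G) (inj₁ (Equivalence.from (singleton⇔ (atLeastK r τ τ-in) G) (Equivalence.from (atLeast⇔ G r τ K) K≤N)))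
        ... | no  K≰N = let i , i≡N = count-at (≰⇒> K≰N) in
          Equivalence.from (++⇔ _ _ G) (inj₂ (Equivalence.from (someAtom⇔ (λ i → m ≤? toℕ i) exactlyAt G)
            (i , subst (m ≤_) (≡.sym i≡N) m≤N , Equivalence.from (exactlyAt⇔ i) (≡.sym i≡N))))

      belowDNF⇔ : ∀ {m} → m ≤ K → ⟦ belowDNF m ⟧ᴰ G ⇔ (N < m)
      belowDNF⇔ {m} m≤K = mk⇔
        (λ s → let i , i<m , N≡i = Equivalence.to (someAtom⇔ (λ i → toℕ i <? m) exactlyAt G) s in
               subst (_< m) (≡.sym (Equivalence.to (exactlyAt⇔ i) N≡i)) i<m)
        (λ N<m → let i , i≡N = count-at (<-≤-trans N<m m≤K) in
                 Equivalence.from (someAtom⇔ (λ i → toℕ i <? m) exactlyAt G)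
                   (i , subst (_< m) (≡.sym i≡N) N<m , Equivalence.from (exactlyAt⇔ i) (≡.sym i≡N)))

      congDNF⇔ : ∀ l j → ⟦ congDNF l j ⟧ᴰ G ⇔ CongMod N j (suc l)
      congDNF⇔ l j = mk⇔
        (λ s → ≡.trans (Equivalence.to residue⇔ (Equivalence.to (singleton⇔ jAtom G) s)) (m%n%n≡m%n j (suc l)))
        (λ N≡j → Equivalence.from (singleton⇔ jAtom G) (Equivalence.from residue⇔ (≡.trans N≡j (≡.sym (m%n%n≡m%n j (suc l))))))
        where
        jAtom = modJ (j % suc l) (suc l) (m%n<n j (suc l)) r τ τ-in
        residue⇔ = countMod⇔ G r τ (j % suc l) (suc l)

      incongDNF⇔ : ∀ l j → ⟦ incongDNF l j ⟧ᴰ G ⇔ (¬ CongMod N j (suc l))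
      incongDNF⇔ l j = mk⇔
        (λ s N≡j → let c , c≢j , N≡c = Equivalence.to (someAtom⇔ other? (residueAtom l) G) s in
                   c≢j (≡.trans (≡.sym (residue c (Equivalence.to (countMod⇔ G r τ (toℕ c) (suc l)) N≡c))) N≡j))
        (λ N≢j → let c = fromℕ< (m%n<n N (suc l)) ; c≡N = toℕ-fromℕ< (m%n<n N (suc l)) in
                 Equivalence.from (someAtom⇔ other? (residueAtom l) G)
                   (c , (λ c≡j → N≢j (≡.trans (≡.sym c≡N) c≡j)) ,
                    Equivalence.from (countMod⇔ G r τ (toℕ c) (suc l))
                      (≡.trans (≡.sym (m%n%n≡m%n N (suc l))) (cong (_% suc l) (≡.sym c≡N)))))
        where
        other? = λ (c : Fin (suc l)) → ¬? (toℕ c ℕ.≟ j % suc l)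
        residue : ∀ (c : Fin (suc l)) → CongMod N (toℕ c) (suc l) → N % suc l ≡ toℕ c
        residue c N≡c = ≡.trans N≡c (m<n⇒m%n≡m (toℕ<n c))

module _ {d : ℕ} where

  threshold : HNF d → ℕ
  threshold (hanf (hAtLeast m _ _ _))   = m
  threshold (hanf (hMod _ _ _ _ _ _))   = 0
  threshold (hneg φ)    = threshold φ
  threshold (hconj φ ψ) = threshold φ ⊔ threshold ψ
  threshold (hdisj φ ψ) = threshold φ ⊔ threshold ψ

  module _ {K : ℕ} where

    -- literal h b and dnf b φ express that h, respectively φ, has truth value b.
    literal : HanfSentence d → Bool → DNF d K
    literal (hAtLeast m r τ τ-in)        true  = atLeastDNF r τ τ-in m
    literal (hAtLeast m r τ τ-in)        false = belowDNF r τ τ-in m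
    literal (hMod j (suc l) _ r τ τ-in) true  = congDNF r τ τ-in l j
    literal (hMod j (suc l) _ r τ τ-in) false = incongDNF r τ τ-in l j

    dnf : Bool → HNF d → DNF d K
    dnf b     (hanf h)    = literal h b
    dnf b     (hneg φ)    = dnf (not b) φ
    dnf true  (hconj φ ψ) = dnf true φ ∧ᴰ dnf true ψ
    dnf false (hconj φ ψ) = dnf false φ ++ dnf false ψ
    dnf true  (hdisj φ ψ) = dnf true φ ++ dnf true ψ
    dnf false (hdisj φ ψ) = dnf false φ ∧ᴰ dnf false ψ

    literal⇔ : ∀ h → threshold (hanf h) ≤ K → ∀ b G → ⟦ literal h b ⟧ᴰ G ⇔ (hanfValue G h ≡ b)
    literal⇔ (hAtLeast m r τ τ-in) m≤K true G =
      ≤⇔≤ᵇ m (typeCount G r τ) ⇔-∘ atLeastDNF⇔ r τ τ-in G m≤K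
    literal⇔ (hAtLeast m r τ τ-in) m≤K false G =
      ¬⇔≡false (≤⇔≤ᵇ m (typeCount G r τ)) ⇔-∘ (mk⇔ <⇒≱ ≰⇒> ⇔-∘ belowDNF⇔ r τ τ-in G m≤K)
    literal⇔ (hMod j (suc l) _ r τ τ-in) _ true G =
      congMod⇔congModᵇ (typeCount G r τ) j (suc l) ⇔-∘ congDNF⇔ r τ τ-in G l j
    literal⇔ (hMod j (suc l) _ r τ τ-in) _ false G =
      ¬⇔≡false (congMod⇔congModᵇ (typeCount G r τ) j (suc l)) ⇔-∘ incongDNF⇔ r τ τ-in G l j

    dnf⇔ : ∀ φ → threshold φ ≤ K → ∀ b G → ⟦ dnf b φ ⟧ᴰ G ⇔ (hnfValue G φ ≡ b)
    dnf⇔ (hanf h)    bound b     G = literal⇔ h bound b G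
    dnf⇔ (hneg φ)    bound b     G = not≡⇔ (hnfValue G φ) b ⇔-∘ dnf⇔ φ bound (not b) G
    dnf⇔ (hconj φ ψ) bound true  G =
      ∧≡true⇔ _ _ ⇔-∘ ((dnf⇔ φ (m⊔n≤o⇒m≤o _ _ bound) true G ×-⇔ dnf⇔ ψ (m⊔n≤o⇒n≤o _ _ bound) true G) ⇔-∘ ∧ᴰ⇔ _ _ G)
    dnf⇔ (hconj φ ψ) bound false G =
      ∧≡false⇔ _ _ ⇔-∘ ((dnf⇔ φ (m⊔n≤o⇒m≤o _ _ bound) false G ⊎-⇔ dnf⇔ ψ (m⊔n≤o⇒n≤o _ _ bound) false G) ⇔-∘ ++⇔ _ _ G)
    dnf⇔ (hdisj φ ψ) bound true  G =
      ∨≡true⇔ _ _ ⇔-∘ ((dnf⇔ φ (m⊔n≤o⇒m≤o _ _ bound) true G ⊎-⇔ dnf⇔ ψ (m⊔n≤o⇒n≤o _ _ bound) true G) ⇔-∘ ++⇔ _ _ G)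
    dnf⇔ (hdisj φ ψ) bound false G =
      ∨≡false⇔ _ _ ⇔-∘ ((dnf⇔ φ (m⊔n≤o⇒m≤o _ _ bound) false G ×-⇔ dnf⇔ ψ (m⊔n≤o⇒n≤o _ _ bound) false G) ⇔-∘ ∧ᴰ⇔ _ _ G)

  Occurs : ∀ {K} → HNF d → DNF d K → Set
  Occurs φ ψ = All (All (λ a → OccursIn (atomRadius a) (atomType a) φ)) ψ

  module _ {K : ℕ} where

    weaken : ∀ φ φ′ {ψ : DNF d K} → (∀ {r τ} → OccursIn r τ φ → OccursIn r τ φ′) → Occurs φ ψ → Occurs φ′ ψ
    weaken φ φ′ φ⊆φ′ = All.map (All.map φ⊆φ′)

    literal-occurs : ∀ h b → Occurs {K} (hanf h) (literal h b)
    literal-occurs (hAtLeast m r τ τ-in)        true  = atLeastDNF-uniform r τ τ-in m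
    literal-occurs (hAtLeast m r τ τ-in)        false = belowDNF-uniform r τ τ-in m
    literal-occurs (hMod j (suc l) _ r τ τ-in) true  = congDNF-uniform r τ τ-in l j
    literal-occurs (hMod j (suc l) _ r τ τ-in) false = incongDNF-uniform r τ τ-in l j

    dnf-occurs : ∀ b φ → Occurs φ (dnf {K = K} b φ)
    dnf-occurs b     (hanf h)    = literal-occurs h b
    dnf-occurs b     (hneg φ)    = dnf-occurs (not b) φ
    dnf-occurs true  (hconj φ ψ) = ∧ᴰ-all (weaken φ (hconj φ ψ) inj₁ (dnf-occurs true φ)) (weaken ψ (hconj φ ψ) inj₂ (dnf-occurs true ψ))
    dnf-occurs false (hconj φ ψ) = Allₚ.++⁺ (weaken φ (hconj φ ψ) inj₁ (dnf-occurs false φ)) (weaken ψ (hconj φ ψ) inj₂ (dnf-occurs false ψ))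
    dnf-occurs true  (hdisj φ ψ) = Allₚ.++⁺ (weaken φ (hdisj φ ψ) inj₁ (dnf-occurs true φ)) (weaken ψ (hdisj φ ψ) inj₂ (dnf-occurs true ψ))
    dnf-occurs false (hdisj φ ψ) = ∧ᴰ-all (weaken φ (hdisj φ ψ) inj₁ (dnf-occurs false φ)) (weaken ψ (hdisj φ ψ) inj₂ (dnf-occurs false ψ))

  hnf⇒dnf : (φ : HNF d) → Σ ℕ λ k → Σ (DNF d k) λ ψ → (⟦ φ ⟧ᴴ ≡[ d ] ⟦ ψ ⟧ᴰ) × Occurs φ ψ
  hnf⇒dnf φ = threshold φ , dnf true φ , (λ G _ → Equivalence.from (dnf⇔′ G) ∘ Equivalence.to (hnfValue⇔ G φ)
                                                 , Equivalence.from (hnfValue⇔ G φ) ∘ Equivalence.to (dnf⇔′ G))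
                          , dnf-occurs true φ
    where dnf⇔′ = dnf⇔ φ ≤-refl true

≡[]-trans : ∀ {d} {P Q R : Graph → Set} → P ≡[ d ] Q → Q ≡[ d ] R → P ≡[ d ] R
≡[]-trans P≡Q Q≡R G G-deg =
  (λ p → proj₁ (Q≡R G G-deg) (proj₁ (P≡Q G G-deg) p)) , (λ r → proj₂ (P≡Q G G-deg) (proj₂ (Q≡R G G-deg) r))

lemma3p3 : (d : ℕ) →
    ((φ : Sentence) →
      Σ ℕ λ k → Σ (DNF d k) λ ψ → (λ G → G ⊨ φ) ≡[ d ] ⟦ ψ ⟧ᴰ)
    ×
    ((φ : HNF d) →
      Σ ℕ λ k → Σ (DNF d k) λ ψ →
        (⟦ φ ⟧ᴴ ≡[ d ] ⟦ ψ ⟧ᴰ) ×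
        All (All (λ a → OccursIn (atomRadius a) (atomType a) φ)) ψ)
lemma3p3 d = sentence-case , hnf⇒dnf
  where
  sentence-case : (φ : Sentence) → Σ ℕ λ k → Σ (DNF d k) λ ψ → (λ G → G ⊨ φ) ≡[ d ] ⟦ ψ ⟧ᴰ
  sentence-case φ =
    let χ , φ≡χ = hanf-normal-form φ
        k , ψ , χ≡ψ , _ = hnf⇒dnf χ
    in k , ψ , ≡[]-trans φ≡χ χ≡ψ
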